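{- If $v$ is a simplicial vertex in a graph $G$, then $\mathcal{A}(G)>\mathcal{A}(G-v)$.
   Context: All graphs are finite, simple and undirected; $G$ has at least two vertices. A coloring of a graph $G$ assigns colors to its vertices so that adjacent vertices receive different colors; two colorings are equivalent if they induce the same partition of the vertex set into color classes. $S(G,k)$ denotes the number of non-equivalent colorings of $G$ using exactly $k$ colors. Set $\mathcal{B}(G)=\sum_{k\ge1}S(G,k)$, $\mathcal{T}(G)=\sum_{k\ge1}kS(G,k)$ and $\mathcal{A}(G)=\mathcal{T}(G)/\mathcal{B}(G)$. A vertex is simplicial if its neighbors induce a clique (an isolated vertex is simplicial). $G-v$ is obtained by deleting $v$ and its incident edges. -}

module Defs where

open import Data.Bool using (Bool; true; false; _∧_; not; if_then_else_)
open import Data.Nat using (ℕ; zero; suc; _+_; _*_; _<ᵇ_; _≡ᵇ_)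
open import Data.Fin using (Fin; zero; suc; toℕ; punchIn)
open import Data.List using (List; []; _∷_; map; concatMap; allFin; filterᵇ; length; upTo)
open import Data.Nat.ListAction using (sum)
open import Data.List using (foldr)
open import Data.Integer using (+_)
open import Data.Rational using (ℚ; _/_; 0ℚ)
open import Relation.Binary.PropositionalEquality using (_≡_; _≢_)

all : ∀ {A : Set} → (A → Bool) → List A → Bool
all p = foldr (λ x b → p x ∧ b) true

record Graph (n : ℕ) : Set where
  field
    adj    : Fin n → Fin n → Bool
    sym    : ∀ i j → adj i j ≡ adj j i
    irrefl : ∀ i → adj i i ≡ false
open Graph public

_─_ : ∀ {n} → Graph (suc n) → Fin (suc n) → Graph n
adj    (G ─ v) i j = adj G (punchIn v i) (punchIn v j)
sym    (G ─ v) i j = sym G (punchIn v i) (punchIn v j)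
irrefl (G ─ v) i   = irrefl G (punchIn v i)

Simplicial : ∀ {n} → Graph n → Fin n → Set
Simplicial G v = ∀ u w → adj G v u ≡ true → adj G v w ≡ true → u ≢ w → adj G u w ≡ true

-- Enumeration of all functions Fin n → A, given a list of all elements of A
-- (each function appears exactly once, up to pointwise equality).
enumFun : ∀ {A : Set} (n : ℕ) → List A → List (Fin n → A)
enumFun zero    xs = (λ ()) ∷ []
enumFun (suc n) xs =
  concatMap (λ a → map (λ f → λ { zero → a ; (suc i) → f i }) (enumFun n xs)) xs

allRels : (n : ℕ) → List (Fin n → Fin n → Bool)
allRels n = enumFun n (enumFun n (true ∷ false ∷ []))

-- A partition of the vertex set is represented by its equivalence relation
-- (i R j iff i and j lie in the same block).
isEquivRel : ∀ {n} → (Fin n → Fin n → Bool) → Bool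
isEquivRel {n} R =
  all (λ i → R i i) (allFin n) ∧
  (all (λ i → all (λ j → not (R i j) ∨' R j i) (allFin n)) (allFin n) ∧
   all (λ i → all (λ j → all (λ k → not (R i j ∧ R j k) ∨' R i k) (allFin n)) (allFin n)) (allFin n))
  where
  _∨'_ : Bool → Bool → Bool
  true  ∨' _ = true
  false ∨' b = b

-- Every block is an independent set of G (i.e. the partition is the set of
-- colour classes of a proper colouring).
blocksIndependent : ∀ {n} → Graph n → (Fin n → Fin n → Bool) → Bool
blocksIndependent {n} G R =
  all (λ i → all (λ j → not (R i j ∧ adj G i j)) (allFin n)) (allFin n)

-- Number of blocks: number of vertices that are the least element of their block.
numBlocks : ∀ {n} → (Fin n → Fin n → Bool) → ℕ
numBlocks {n} R =
  length (filterᵇ (λ i → all (λ j → not (R j i ∧ (toℕ j <ᵇ toℕ i))) (allFin n)) (allFin n))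

isColoringPartition : ∀ {n} → Graph n → (Fin n → Fin n → Bool) → Bool
isColoringPartition G R = isEquivRel R ∧ blocksIndependent G R

S : ∀ {n} → Graph n → ℕ → ℕ
S {n} G k = length (filterᵇ (λ R → isColoringPartition G R ∧ (numBlocks R ≡ᵇ k)) (allRels n))

-- B(G) = Σ_{k≥1} S(G,k), T(G) = Σ_{k≥1} k S(G,k).  S(G,k) = 0 for k > n,
-- so the sums range over k = 1 .. n.
𝓑 : ∀ {n} → Graph n → ℕ
𝓑 {n} G = sum (map (λ k → S G (suc k)) (upTo n))

𝓣 : ∀ {n} → Graph n → ℕ
𝓣 {n} G = sum (map (λ k → suc k * S G (suc k)) (upTo n))

-- t / b as a rational (b = 0 never occurs for graphs with ≥ 1 vertex; the
-- value 0 is then a harmless default).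
ratio : ℕ → ℕ → ℚ
ratio t zero    = 0ℚ
ratio t (suc b) = (+ t) / suc b

𝓐 : ∀ {n} → Graph n → ℚ
𝓐 G = ratio (𝓣 G) (𝓑 G)

-- A colouring of G restricts to one of G − v, and a colouring R′ of G − v with b blocks
-- lifts to G in 1 + J ways: v forms a block of its own, or joins one of the J blocks
-- containing no neighbour of v.  As the neighbours of a simplicial vertex form a clique,
-- each block contains at most one of them, so J = b − d with d = deg v.  Summing over R′,
--   𝓑 G = 𝓑 H + 𝓣 H − d 𝓑 H   and   𝓣 G = 𝓑 H + 𝓣 H + M₂ − d 𝓣 H,
-- where H = G − v and M₂ = Σ b².  With 𝓣 H² ≤ 𝓑 H · M₂ (Cauchy–Schwarz) these give
-- 𝓣 H · 𝓑 G < 𝓣 G · 𝓑 H, i.e. 𝓐 H < 𝓐 G.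

module Submission where

open import Defs hiding (sym)
open import Data.Bool using (Bool; true; false; _∧_; not; T)
import Data.Bool as Bool using (_≟_)
open import Data.Bool.Properties using (∧-conicalˡ; ∧-conicalʳ; ∧-identityʳ; ∧-comm)
open import Data.Empty using (⊥; ⊥-elim)
open import Data.Fin using (Fin; zero; suc; toℕ; punchIn; _≟_)
open import Data.Fin.Properties using (punchIn-punchOut; punchInᵢ≢i; punchIn-injective; toℕ-injective)
import Data.Integer as ℤ using (+_; _<_; +<+)
import Data.Integer.Properties as ℤ using (pos-*)
open import Data.List using (List; []; _∷_; _++_; map; concatMap; allFin; tabulate; applyUpTo; upTo; filterᵇ; length)
open import Data.List.Membership.Propositional using (_∈_)
open import Data.List.Membership.Propositional.Properties using (∈-allFin)
open import Data.List.Properties using (map-++; map-∘)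
open import Data.List.Relation.Unary.Any using (here; there)
open import Data.Maybe using (Maybe; just; nothing)
import Data.Maybe as Maybe using (map)
open import Data.Nat using (ℕ; zero; suc; _+_; _*_; _≤_; _<_; _<ᵇ_; _≡ᵇ_; z≤n; s≤s)
open import Data.Nat.ListAction using (sum)
open import Data.Nat.ListAction.Properties using (sum-++)
import Data.Nat.Properties as ℕ
open import Data.Nat.Solver using (module +-*-Solver)
open import Data.Product using (Σ; ∃; _×_; _,_; proj₁; proj₂)
import Data.Rational as ℚ using (_<_)
open import Data.Rational.Properties using (toℚᵘ-fromℚᵘ; toℚᵘ-cancel-<)
open import Data.Rational.Unnormalised using (mkℚᵘ; *<*)
import Data.Rational.Unnormalised.Properties as ℚᵘ using (<-respˡ-≃; <-respʳ-≃; ≃-sym)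
open import Data.Sum using (_⊎_; inj₁; inj₂)
open import Data.Unit using (tt)
open import Function using (_∘_; id)
open import Relation.Binary.PropositionalEquality
open import Relation.Nullary using (yes; no; does)
open import Relation.Nullary.Decidable using (dec-true)

open import Algebra.Properties.CommutativeSemigroup ℕ.+-commutativeSemigroup
  using () renaming (interchange to +-interchange)
open import Algebra.Properties.Semiring.Sum ℕ.+-*-semiring
  using (sum-syntax; sum-cong-≗; sum-remove; ∑-distrib-+; ∑-comm; *-distribˡ-sum; sum-replicate-zero)
  renaming (sum to ∑)
open +-*-Solver using (solve; _:*_; _:+_; _:=_; con)

true≢false : true ≢ false
true≢false ()

true-⇔⇒≡ : ∀ {a b} → (a ≡ true → b ≡ true) → (b ≡ true → a ≡ true) → a ≡ b
true-⇔⇒≡ {true}  {true}  a⇒b b⇒a = refl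
true-⇔⇒≡ {true}  {false} a⇒b b⇒a = sym (a⇒b refl)
true-⇔⇒≡ {false} {true}  a⇒b b⇒a = b⇒a refl
true-⇔⇒≡ {false} {false} a⇒b b⇒a = refl

∧-true : ∀ {a b} → a ≡ true → b ≡ true → a ∧ b ≡ true
∧-true refl b≡true = b≡true

∧-false : ∀ a {b} → a ∧ b ≡ false → a ≡ false ⊎ b ≡ false
∧-false true  b≡false = inj₂ b≡false
∧-false false _       = inj₁ refl

not-true⁻ : ∀ {b} → not b ≡ true → b ≡ false
not-true⁻ {false} _ = refl

not-false⁻ : ∀ {b} → not b ≡ false → b ≡ true
not-false⁻ {true} _ = refl

not-∧-true⁻ : ∀ {a b} → not (a ∧ b) ≡ true → a ≡ true → b ≡ false
not-∧-true⁻ {true} {false} _ _ = refl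

not-∧-true⁺ : ∀ {a b} → (a ≡ true → b ≡ false) → not (a ∧ b) ≡ true
not-∧-true⁺ {true}  {true}  a⇒¬b = sym (a⇒¬b refl)
not-∧-true⁺ {true}  {false} _    = refl
not-∧-true⁺ {false}         _    = refl

𝟙 : Bool → ℕ
𝟙 true  = 1
𝟙 false = 0

𝟙-∧ : ∀ a b → 𝟙 (a ∧ b) ≡ 𝟙 a * 𝟙 b
𝟙-∧ true  b = sym (ℕ.+-identityʳ (𝟙 b))
𝟙-∧ false b = refl

𝟙-split : ∀ c b → 𝟙 (c ∧ b) + 𝟙 (not c ∧ b) ≡ 𝟙 b
𝟙-split true  b = ℕ.+-identityʳ (𝟙 b)
𝟙-split false b = refl

𝟙≤1 : ∀ b → 𝟙 b ≤ 1
𝟙≤1 true  = s≤s z≤n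
𝟙≤1 false = z≤n

𝟙-*-≤ : ∀ b x → 𝟙 b * x ≤ x
𝟙-*-≤ true  x = ℕ.≤-reflexive (ℕ.+-identityʳ x)
𝟙-*-≤ false x = z≤n

𝟙-*-cong : ∀ b {x y} → (b ≡ true → x ≡ y) → 𝟙 b * x ≡ 𝟙 b * y
𝟙-*-cong true  x≡y = cong (_+ 0) (x≡y refl)
𝟙-*-cong false x≡y = refl

𝟙-*-exclusive : ∀ {a b} → (a ≡ true → b ≡ true → ⊥) → 𝟙 a * 𝟙 b ≡ 0
𝟙-*-exclusive {true}  {true}  ¬ab = ⊥-elim (¬ab refl refl)
𝟙-*-exclusive {true}  {false} ¬ab = refl
𝟙-*-exclusive {false}         ¬ab = refl

𝟙-∧-absorb : ∀ a {b c} → (c ≡ true → b ≡ true) → 𝟙 (a ∧ b) * 𝟙 c ≡ 𝟙 a * 𝟙 c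
𝟙-∧-absorb a {c = true}  c⇒b rewrite c⇒b refl | ∧-identityʳ a = refl
𝟙-∧-absorb a {b} {false} _ = trans (ℕ.*-zeroʳ (𝟙 (a ∧ b))) (sym (ℕ.*-zeroʳ (𝟙 a)))

module _ {A : Set} {p : A → Bool} where

  all-true⁻ : ∀ {xs} → all p xs ≡ true → ∀ {x} → x ∈ xs → p x ≡ true
  all-true⁻ {y ∷ ys} all≡true (here refl) = ∧-conicalˡ (p y) _ all≡true
  all-true⁻ {y ∷ ys} all≡true (there x∈ys) = all-true⁻ (∧-conicalʳ (p y) _ all≡true) x∈ys

  all-true⁺ : ∀ xs → (∀ {x} → x ∈ xs → p x ≡ true) → all p xs ≡ true
  all-true⁺ []       _    = refl
  all-true⁺ (y ∷ ys) p≡true = ∧-true (p≡true (here refl)) (all-true⁺ ys (p≡true ∘ there))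

  all-false⁻ : ∀ xs → all p xs ≡ false → ∃ λ x → p x ≡ false
  all-false⁻ (y ∷ ys) all≡false with ∧-false (p y) all≡false
  ... | inj₁ py≡false = y , py≡false
  ... | inj₂ rest≡false = all-false⁻ ys rest≡false

all-cong : ∀ {A : Set} {p q : A → Bool} xs → (∀ x → p x ≡ q x) → all p xs ≡ all q xs
all-cong []       p≡q = refl
all-cong (x ∷ xs) p≡q = cong₂ _∧_ (p≡q x) (all-cong xs p≡q)

module _ {n : ℕ} {p : Fin n → Bool} where

  allFin-true⁻ : all p (allFin n) ≡ true → ∀ i → p i ≡ true
  allFin-true⁻ all≡true i = all-true⁻ all≡true (∈-allFin i)

  allFin-true⁺ : (∀ i → p i ≡ true) → all p (allFin n) ≡ true
  allFin-true⁺ p≡true = all-true⁺ (allFin n) (λ {i} _ → p≡true i)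

  allFin-false⁻ : all p (allFin n) ≡ false → ∃ λ i → p i ≡ false
  allFin-false⁻ = all-false⁻ (allFin n)

data PunchInView {n : ℕ} (v : Fin (suc n)) : Fin (suc n) → Set where
  at-v    : PunchInView v v
  punched : ∀ i → PunchInView v (punchIn v i)

punchIn-view : ∀ {n} (v x : Fin (suc n)) → PunchInView v x
punchIn-view v x with v ≟ x
... | yes refl = at-v
... | no v≢x   = subst (PunchInView v) (punchIn-punchOut v≢x) (punched _)

allFin-punchIn : ∀ {n} (v : Fin (suc n)) (p : Fin (suc n) → Bool) →
  all p (allFin (suc n)) ≡ p v ∧ all (p ∘ punchIn v) (allFin n)
allFin-punchIn v p = true-⇔⇒≡ split join
  where
  split : all p (allFin _) ≡ true → p v ∧ all (p ∘ punchIn v) (allFin _) ≡ true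
  split all≡true = ∧-true (allFin-true⁻ all≡true v) (allFin-true⁺ (allFin-true⁻ all≡true ∘ punchIn v))
  join : p v ∧ all (p ∘ punchIn v) (allFin _) ≡ true → all p (allFin _) ≡ true
  join both = allFin-true⁺ λ x → at x (punchIn-view v x)
    where
    at : ∀ x → PunchInView v x → p x ≡ true
    at _ at-v        = ∧-conicalˡ (p v) _ both
    at _ (punched i) = allFin-true⁻ (∧-conicalʳ (p v) _ both) i

-- Finite sums

∑ₗ : ∀ {A : Set} → List A → (A → ℕ) → ℕ
∑ₗ xs f = sum (map f xs)

infixl 10 ∑ₗ
syntax ∑ₗ xs (λ x → e) = ∑[ x ∈ xs ] e

module _ {A : Set} where

  ∑ₗ-cong : ∀ xs {f g : A → ℕ} → (∀ x → f x ≡ g x) → ∑ₗ xs f ≡ ∑ₗ xs g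
  ∑ₗ-cong []       f≡g = refl
  ∑ₗ-cong (x ∷ xs) f≡g = cong₂ _+_ (f≡g x) (∑ₗ-cong xs f≡g)

  ∑ₗ-mono : ∀ xs {f g : A → ℕ} → (∀ x → f x ≤ g x) → ∑ₗ xs f ≤ ∑ₗ xs g
  ∑ₗ-mono []       f≤g = z≤n
  ∑ₗ-mono (x ∷ xs) f≤g = ℕ.+-mono-≤ (f≤g x) (∑ₗ-mono xs f≤g)

  ∑ₗ-distrib-+ : ∀ xs (f g : A → ℕ) → ∑[ x ∈ xs ] (f x + g x) ≡ ∑ₗ xs f + ∑ₗ xs g
  ∑ₗ-distrib-+ []       f g = refl
  ∑ₗ-distrib-+ (x ∷ xs) f g = trans (cong (f x + g x +_) (∑ₗ-distrib-+ xs f g)) (+-interchange (f x) (g x) _ _)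

  *-distribˡ-∑ₗ : ∀ xs c (f : A → ℕ) → ∑[ x ∈ xs ] (c * f x) ≡ c * ∑ₗ xs f
  *-distribˡ-∑ₗ []       c f = sym (ℕ.*-zeroʳ c)
  *-distribˡ-∑ₗ (x ∷ xs) c f = trans (cong (c * f x +_) (*-distribˡ-∑ₗ xs c f)) (sym (ℕ.*-distribˡ-+ c (f x) _))

  *-distribʳ-∑ₗ : ∀ xs c (f : A → ℕ) → ∑[ x ∈ xs ] (f x * c) ≡ ∑ₗ xs f * c
  *-distribʳ-∑ₗ xs c f = trans (∑ₗ-cong xs (λ x → ℕ.*-comm (f x) c)) (trans (*-distribˡ-∑ₗ xs c f) (ℕ.*-comm c _))

  ∑ₗ-zero : ∀ xs (f : A → ℕ) → (∀ x → f x ≡ 0) → ∑ₗ xs f ≡ 0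
  ∑ₗ-zero []       f f≡0 = refl
  ∑ₗ-zero (x ∷ xs) f f≡0 = cong₂ _+_ (f≡0 x) (∑ₗ-zero xs f f≡0)

  ∑ₗ-++ : ∀ xs ys (f : A → ℕ) → ∑ₗ (xs ++ ys) f ≡ ∑ₗ xs f + ∑ₗ ys f
  ∑ₗ-++ xs ys f = trans (cong sum (map-++ f xs ys)) (sum-++ (map f xs) (map f ys))

  ∑ₗ-map : ∀ {B : Set} (g : B → A) xs (f : A → ℕ) → ∑ₗ (map g xs) f ≡ ∑ₗ xs (f ∘ g)
  ∑ₗ-map g xs f = cong sum (sym (map-∘ xs))

  ∑ₗ-concatMap : ∀ {B : Set} (g : B → List A) xs (f : A → ℕ) → ∑ₗ (concatMap g xs) f ≡ ∑[ x ∈ xs ] ∑ₗ (g x) f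
  ∑ₗ-concatMap g []       f = refl
  ∑ₗ-concatMap g (x ∷ xs) f = trans (∑ₗ-++ (g x) (concatMap g xs) f) (cong (∑ₗ (g x) f +_) (∑ₗ-concatMap g xs f))

  length-filterᵇ : ∀ (p : A → Bool) xs → length (filterᵇ p xs) ≡ ∑[ x ∈ xs ] 𝟙 (p x)
  length-filterᵇ p []       = refl
  length-filterᵇ p (x ∷ xs) with p x
  ... | true  = cong suc (length-filterᵇ p xs)
  ... | false = length-filterᵇ p xs

∑ₗ-comm : ∀ {A B : Set} (xs : List A) (ys : List B) (f : A → B → ℕ) →
  ∑[ x ∈ xs ] ∑[ y ∈ ys ] f x y ≡ ∑[ y ∈ ys ] ∑[ x ∈ xs ] f x y
∑ₗ-comm []       ys f = sym (∑ₗ-zero ys _ (λ _ → refl))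
∑ₗ-comm (x ∷ xs) ys f = trans (cong (∑ₗ ys (f x) +_) (∑ₗ-comm xs ys f)) (sym (∑ₗ-distrib-+ ys (f x) _))

∑ₗ-combine : ∀ {A : Set} xs (f g : A → ℕ) d → ∑ₗ xs f + d * ∑ₗ xs g ≡ ∑[ x ∈ xs ] (f x + d * g x)
∑ₗ-combine xs f g d = trans (cong (∑ₗ xs f +_) (sym (*-distribˡ-∑ₗ xs d g))) (sym (∑ₗ-distrib-+ xs f (λ x → d * g x)))

∑ₗ-tabulate : ∀ {A : Set} {n} (g : Fin n → A) f → ∑ₗ (tabulate g) f ≡ ∑[ i < n ] f (g i)
∑ₗ-tabulate {n = zero}  g f = refl
∑ₗ-tabulate {n = suc n} g f = cong (f (g zero) +_) (∑ₗ-tabulate (g ∘ suc) f)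

∑ₗ-allFin : ∀ n (f : Fin n → ℕ) → ∑ₗ (allFin n) f ≡ ∑ f
∑ₗ-allFin n = ∑ₗ-tabulate id

∑-∑ₗ-comm : ∀ {A : Set} {n} (xs : List A) (f : Fin n → A → ℕ) → ∑[ i < n ] ∑ₗ xs (f i) ≡ ∑[ x ∈ xs ] ∑[ i < n ] f i x
∑-∑ₗ-comm {n = n} xs f = trans (sym (∑ₗ-allFin n (λ i → ∑ₗ xs (f i))))
  (trans (∑ₗ-comm (allFin n) xs f) (∑ₗ-cong xs (λ x → ∑ₗ-allFin n (λ i → f i x))))

∑ₗ-applyUpTo : ∀ {A : Set} (g : ℕ → A) n f → ∑ₗ (applyUpTo g n) f ≡ ∑[ i < n ] f (g (toℕ i))
∑ₗ-applyUpTo g zero    f = refl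
∑ₗ-applyUpTo g (suc n) f = cong (f (g 0) +_) (∑ₗ-applyUpTo (g ∘ suc) n f)

∑-zero : ∀ {n} (f : Fin n → ℕ) → (∀ i → f i ≡ 0) → ∑ f ≡ 0
∑-zero {n} f f≡0 = trans (sum-cong-≗ f≡0) (sum-replicate-zero n)

∑-single : ∀ {n} (f : Fin n → ℕ) (m : Fin n) → (∀ i → i ≢ m → f i ≡ 0) → ∑ f ≡ f m
∑-single {suc n} f m f≡0 = trans (sum-remove {i = m} f)
  (trans (cong (f m +_) (∑-zero _ (λ i → f≡0 (punchIn m i) (punchInᵢ≢i m i)))) (ℕ.+-identityʳ (f m)))

∑-𝟙≤ : ∀ {n} (p : Fin n → Bool) → ∑[ i < n ] 𝟙 (p i) ≤ n
∑-𝟙≤ {zero}  p = z≤n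
∑-𝟙≤ {suc n} p = ℕ.+-mono-≤ (𝟙≤1 (p zero)) (∑-𝟙≤ (p ∘ suc))

*-distribʳ-∑ : ∀ {n} c (f : Fin n → ℕ) → ∑[ i < n ] (f i * c) ≡ ∑ f * c
*-distribʳ-∑ c f = trans (sum-cong-≗ (λ i → ℕ.*-comm (f i) c)) (trans (sym (*-distribˡ-sum c f)) (ℕ.*-comm c _))

∑-select : ∀ N b (f : ℕ → ℕ) → 1 ≤ b → b ≤ N → ∑[ i < N ] (𝟙 (b ≡ᵇ suc (toℕ i)) * f (suc (toℕ i))) ≡ f b
∑-select (suc N) 1             f _ _ = trans (cong₂ _+_ (ℕ.+-identityʳ (f 1)) (∑-zero {N} _ λ _ → refl)) (ℕ.+-identityʳ (f 1))
∑-select (suc N) (suc (suc b)) f _ (s≤s b<N) = ∑-select N (suc b) (f ∘ suc) (s≤s z≤n) b<N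

2*m*n≤m*m+n*n : ∀ m n → 2 * m * n ≤ m * m + n * n
2*m*n≤m*m+n*n m n with ℕ.≤-total m n
... | inj₁ m≤n with ℕ.m≤n⇒∃[o]m+o≡n m≤n
...   | d , refl = ℕ.≤-trans (ℕ.m≤m+n _ (d * d)) (ℕ.≤-reflexive (identity m d))
  where
  identity : ∀ m d → 2 * m * (m + d) + d * d ≡ m * m + (m + d) * (m + d)
  identity = solve 2 (λ m d → con 2 :* m :* (m :+ d) :+ d :* d := m :* m :+ (m :+ d) :* (m :+ d)) refl
2*m*n≤m*m+n*n m n | inj₂ n≤m with ℕ.m≤n⇒∃[o]m+o≡n n≤m
...   | d , refl = ℕ.≤-trans (ℕ.m≤m+n _ (d * d)) (ℕ.≤-reflexive (identity n d))
  where
  identity : ∀ n d → 2 * (n + d) * n + d * d ≡ (n + d) * (n + d) + n * n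
  identity = solve 2 (λ n d → con 2 :* (n :+ d) :* n :+ d :* d := (n :+ d) :* (n :+ d) :+ n :* n) refl

module _ {A : Set} (a b : A → ℕ) where

  private
    cross : ∀ t xs → 2 * t * ∑[ x ∈ xs ] (a x * b x) ≤ t * t * ∑ₗ xs a + ∑[ x ∈ xs ] (a x * (b x * b x))
    cross t xs = begin
      2 * t * ∑[ x ∈ xs ] (a x * b x)                        ≡⟨ *-distribˡ-∑ₗ xs (2 * t) (λ x → a x * b x) ⟨
      ∑[ x ∈ xs ] (2 * t * (a x * b x))                      ≤⟨ ∑ₗ-mono xs pointwise ⟩
      ∑[ x ∈ xs ] (t * t * a x + a x * (b x * b x))          ≡⟨ ∑ₗ-distrib-+ xs (λ x → t * t * a x) (λ x → a x * (b x * b x)) ⟩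
      ∑[ x ∈ xs ] (t * t * a x) + ∑[ x ∈ xs ] (a x * (b x * b x)) ≡⟨ cong (_+ _) (*-distribˡ-∑ₗ xs (t * t) a) ⟩
      t * t * ∑ₗ xs a + ∑[ x ∈ xs ] (a x * (b x * b x))      ∎
      where
      open ℕ.≤-Reasoning
      pointwise : ∀ x → 2 * t * (a x * b x) ≤ t * t * a x + a x * (b x * b x)
      pointwise x = begin
        2 * t * (a x * b x)             ≡⟨ shuffle t (a x) (b x) ⟩
        a x * (2 * t * b x)             ≤⟨ ℕ.*-monoʳ-≤ (a x) (2*m*n≤m*m+n*n t (b x)) ⟩
        a x * (t * t + b x * b x)       ≡⟨ ℕ.*-distribˡ-+ (a x) (t * t) (b x * b x) ⟩
        a x * (t * t) + a x * (b x * b x) ≡⟨ cong (_+ a x * (b x * b x)) (ℕ.*-comm (a x) (t * t)) ⟩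
        t * t * a x + a x * (b x * b x) ∎
        where
        shuffle : ∀ t α β → 2 * t * (α * β) ≡ α * (2 * t * β)
        shuffle = solve 3 (λ t α β → con 2 :* t :* (α :* β) := α :* (con 2 :* t :* β)) refl

  cauchy-schwarz : ∀ xs → ∑[ x ∈ xs ] (a x * b x) * ∑[ x ∈ xs ] (a x * b x) ≤ ∑ₗ xs a * ∑[ x ∈ xs ] (a x * (b x * b x))
  cauchy-schwarz [] = z≤n
  cauchy-schwarz (x ∷ xs) = begin
    (a x * b x + S₁) * (a x * b x + S₁)
      ≡⟨ expand (a x) (b x) S₁ ⟩
    a x * a x * (b x * b x) + a x * (2 * b x * S₁) + S₁ * S₁
      ≤⟨ ℕ.+-mono-≤ (ℕ.+-monoʳ-≤ (a x * a x * (b x * b x)) (ℕ.*-monoʳ-≤ (a x) (cross (b x) xs))) (cauchy-schwarz xs) ⟩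
    a x * a x * (b x * b x) + a x * (b x * b x * S₀ + S₂) + S₀ * S₂
      ≡⟨ factor (a x) (b x) S₀ S₂ ⟩
    (a x + S₀) * (a x * (b x * b x) + S₂) ∎
    where
    open ℕ.≤-Reasoning
    S₀ S₁ S₂ : ℕ
    S₀ = ∑ₗ xs a
    S₁ = ∑[ y ∈ xs ] (a y * b y)
    S₂ = ∑[ y ∈ xs ] (a y * (b y * b y))
    expand : ∀ α β P → (α * β + P) * (α * β + P) ≡ α * α * (β * β) + α * (2 * β * P) + P * P
    expand = solve 3 (λ α β P → (α :* β :+ P) :* (α :* β :+ P) := α :* α :* (β :* β) :+ α :* (con 2 :* β :* P) :+ P :* P) refl
    factor : ∀ α β A Q → α * α * (β * β) + α * (β * β * A + Q) + A * Q ≡ (α + A) * (α * (β * β) + Q)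
    factor = solve 4 (λ α β A Q → α :* α :* (β :* β) :+ α :* (β :* β :* A :+ Q) :+ A :* Q := (α :+ A) :* (α :* (β :* β) :+ Q)) refl


-- Here B = 𝓑 G, T = 𝓣 G and mₖ = Σ bᵏ over the colourings of G − v (b = number of blocks);
-- the recurrences carry d·mₖ on the left so that no truncated subtraction occurs.
ratio-grows : ∀ m₀ m₁ m₂ d B T → B + d * m₀ ≡ m₀ + m₁ → T + d * m₁ ≡ m₀ + m₁ + m₂ →
  m₁ * m₁ ≤ m₀ * m₂ → 1 ≤ m₀ → m₁ * B < T * m₀
ratio-grows m₀ m₁ m₂ d B T B-rec T-rec cs m₀≥1 = ℕ.+-cancelʳ-< (d * m₁ * m₀) (m₁ * B) (T * m₀) (begin-strict
  m₁ * B + d * m₁ * m₀                ≡⟨ distribute-B ⟩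
  m₁ * (B + d * m₀)                   ≡⟨ cong (m₁ *_) B-rec ⟩
  m₁ * (m₀ + m₁)                      ≡⟨ ℕ.*-distribˡ-+ m₁ m₀ m₁ ⟩
  m₁ * m₀ + m₁ * m₁                   <⟨ ℕ.+-monoʳ-< (m₁ * m₀) squares ⟩
  m₁ * m₀ + (m₀ * m₀ + m₂ * m₀)       ≡⟨ rearrange ⟩
  (m₀ + m₁ + m₂) * m₀                 ≡⟨ cong (_* m₀) T-rec ⟨
  (T + d * m₁) * m₀                   ≡⟨ distribute-T ⟩
  T * m₀ + d * m₁ * m₀                ∎)
  where
  open ℕ.≤-Reasoning
  squares : m₁ * m₁ < m₀ * m₀ + m₂ * m₀
  squares = ℕ.<-≤-trans (ℕ.m<n+m (m₁ * m₁) (ℕ.*-mono-≤ m₀≥1 m₀≥1))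
                        (ℕ.+-monoʳ-≤ (m₀ * m₀) (ℕ.≤-trans cs (ℕ.≤-reflexive (ℕ.*-comm m₀ m₂))))
  distribute-B : m₁ * B + d * m₁ * m₀ ≡ m₁ * (B + d * m₀)
  distribute-B = solve 4 (λ m₁ B d m₀ → m₁ :* B :+ d :* m₁ :* m₀ := m₁ :* (B :+ d :* m₀)) refl m₁ B d m₀
  rearrange : m₁ * m₀ + (m₀ * m₀ + m₂ * m₀) ≡ (m₀ + m₁ + m₂) * m₀
  rearrange = solve 3 (λ m₀ m₁ m₂ → m₁ :* m₀ :+ (m₀ :* m₀ :+ m₂ :* m₀) := (m₀ :+ m₁ :+ m₂) :* m₀) refl m₀ m₁ m₂
  distribute-T : (T + d * m₁) * m₀ ≡ T * m₀ + d * m₁ * m₀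
  distribute-T = solve 4 (λ T d m₁ m₀ → (T :+ d :* m₁) :* m₀ := T :* m₀ :+ d :* m₁ :* m₀) refl T d m₁ m₀

ratio-< : ∀ {t b t′ b′} → 1 ≤ b → 1 ≤ b′ → t * b′ < t′ * b → ratio t b ℚ.< ratio t′ b′
ratio-< {t} {suc b} {t′} {suc b′} _ _ cross = toℚᵘ-cancel-<
  (ℚᵘ.<-respˡ-≃ (ℚᵘ.≃-sym (toℚᵘ-fromℚᵘ (mkℚᵘ (ℤ.+ t) b)))
    (ℚᵘ.<-respʳ-≃ (ℚᵘ.≃-sym (toℚᵘ-fromℚᵘ (mkℚᵘ (ℤ.+ t′) b′)))
      (*<* (subst₂ ℤ._<_ (ℤ.pos-* t (suc b′)) (ℤ.pos-* t′ (suc b)) (ℤ.+<+ cross)))))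

open ≡-Reasoning

pointwiseᵇ : ∀ {A : Set} {n} → (A → A → Bool) → (Fin n → A) → (Fin n → A) → Bool
pointwiseᵇ {n = n} eq f g = all (λ i → eq (f i) (g i)) (allFin n)

enumFun-unique : ∀ {A : Set} n (ys : List A) (eq : A → A → Bool) →
  (∀ a → ∑[ b ∈ ys ] 𝟙 (eq b a) ≡ 1) →
  ∀ f → ∑[ g ∈ enumFun n ys ] 𝟙 (pointwiseᵇ eq g f) ≡ 1
enumFun-unique zero    ys eq unique f = refl
enumFun-unique (suc n) ys eq unique f = begin
  ∑[ g ∈ enumFun (suc n) ys ] 𝟙 (pointwiseᵇ eq g f)
    ≡⟨ trans (∑ₗ-concatMap _ ys _)
             (∑ₗ-cong ys λ a → trans (∑ₗ-map _ (enumFun n ys) _) (∑ₗ-cong (enumFun n ys) (λ g → split _))) ⟩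
  ∑[ a ∈ ys ] ∑[ g ∈ enumFun n ys ] (𝟙 (eq a (f zero)) * 𝟙 (pointwiseᵇ eq g (f ∘ suc)))
    ≡⟨ ∑ₗ-cong ys (λ a → *-distribˡ-∑ₗ (enumFun n ys) (𝟙 (eq a (f zero))) _) ⟩
  ∑[ a ∈ ys ] (𝟙 (eq a (f zero)) * ∑[ g ∈ enumFun n ys ] 𝟙 (pointwiseᵇ eq g (f ∘ suc)))
    ≡⟨ ∑ₗ-cong ys (λ a → cong (𝟙 (eq a (f zero)) *_) (enumFun-unique n ys eq unique (f ∘ suc))) ⟩
  ∑[ a ∈ ys ] (𝟙 (eq a (f zero)) * 1)
    ≡⟨ ∑ₗ-cong ys (λ a → ℕ.*-identityʳ _) ⟩
  ∑[ a ∈ ys ] 𝟙 (eq a (f zero))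
    ≡⟨ unique (f zero) ⟩
  1 ∎
  where
  split : ∀ h → 𝟙 (pointwiseᵇ eq h f) ≡ 𝟙 (eq (h zero) (f zero)) * 𝟙 (pointwiseᵇ eq (h ∘ suc) (f ∘ suc))
  split h = trans (cong 𝟙 (allFin-punchIn zero (λ i → eq (h i) (f i)))) (𝟙-∧ (eq (h zero) (f zero)) _)

BoolRel : ℕ → Set
BoolRel n = Fin n → Fin n → Bool

_==_ : Bool → Bool → Bool
a == b = does (a Bool.≟ b)

==-sound : ∀ {a b} → a == b ≡ true → a ≡ b
==-sound {true}  {true}  _ = refl
==-sound {false} {false} _ = refl

_≈ᵇ_ : ∀ {n} → BoolRel n → BoolRel n → Bool
_≈ᵇ_ = pointwiseᵇ (pointwiseᵇ _==_)

_≐_ : ∀ {n} → BoolRel n → BoolRel n → Set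
R ≐ S = ∀ i j → R i j ≡ S i j

Extensional : ∀ {n} → (BoolRel n → ℕ) → Set
Extensional h = ∀ {R S} → R ≐ S → h R ≡ h S

module _ {n : ℕ} {R S : BoolRel n} where

  ≈ᵇ-sound : R ≈ᵇ S ≡ true → R ≐ S
  ≈ᵇ-sound R≈S i j = ==-sound (allFin-true⁻ (allFin-true⁻ R≈S i) j)

  ≈ᵇ-complete : R ≐ S → R ≈ᵇ S ≡ true
  ≈ᵇ-complete R≐S = allFin-true⁺ λ i → allFin-true⁺ λ j → dec-true (R i j Bool.≟ S i j) (R≐S i j)

allRels-unique : ∀ n (S : BoolRel n) → ∑[ R ∈ allRels n ] 𝟙 (R ≈ᵇ S) ≡ 1
allRels-unique n = enumFun-unique n _ (pointwiseᵇ _==_) (enumFun-unique n _ _==_ ==-unique)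
  where
  ==-unique : ∀ a → ∑[ b ∈ true ∷ false ∷ [] ] 𝟙 (b == a) ≡ 1
  ==-unique true  = refl
  ==-unique false = refl

allRels-select : ∀ n (h : BoolRel n → ℕ) → Extensional h →
  ∀ S → ∑[ R ∈ allRels n ] (𝟙 (R ≈ᵇ S) * h R) ≡ h S
allRels-select n h h-ext S = begin
  ∑[ R ∈ allRels n ] (𝟙 (R ≈ᵇ S) * h R) ≡⟨ ∑ₗ-cong (allRels n) (λ R → 𝟙-*-cong (R ≈ᵇ S) (h-ext ∘ ≈ᵇ-sound)) ⟩
  ∑[ R ∈ allRels n ] (𝟙 (R ≈ᵇ S) * h S) ≡⟨ *-distribʳ-∑ₗ (allRels n) (h S) _ ⟩
  ∑[ R ∈ allRels n ] 𝟙 (R ≈ᵇ S) * h S   ≡⟨ cong (_* h S) (allRels-unique n S) ⟩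
  1 * h S                                ≡⟨ ℕ.*-identityˡ (h S) ⟩
  h S                                    ∎

-- Colourings and their blocks

record IsEquivalenceᵇ {n} (R : BoolRel n) : Set where
  field
    reflexive  : ∀ i → R i i ≡ true
    symmetric  : ∀ i j → R i j ≡ true → R j i ≡ true
    transitive : ∀ i j k → R i j ≡ true → R j k ≡ true → R i k ≡ true

-- The disjunction in `isEquivRel` is local to its where-block and cannot be named
-- here; the symmetry and transitivity tests are recovered by unification, and they
-- compute as soon as the entries of R they inspect are known.
module _ {n : ℕ} {R : BoolRel n} where

  private
    equivalenceTests : Σ (BoolRel n) λ symTest → Σ (Fin n → Fin n → Fin n → Bool) λ transTest →
      isEquivRel R ≡ all (λ i → R i i) (allFin n) ∧
        (all (λ i → all (symTest i) (allFin n)) (allFin n) ∧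
         all (λ i → all (λ j → all (transTest i j) (allFin n)) (allFin n)) (allFin n))
    equivalenceTests = _ , _ , refl

    symTest : BoolRel n
    symTest = proj₁ equivalenceTests

    transTest : Fin n → Fin n → Fin n → Bool
    transTest = proj₁ (proj₂ equivalenceTests)

    reflexivity symmetry transitivity : Bool
    reflexivity  = all (λ i → R i i) (allFin n)
    symmetry     = all (λ i → all (symTest i) (allFin n)) (allFin n)
    transitivity = all (λ i → all (λ j → all (transTest i j) (allFin n)) (allFin n)) (allFin n)

    isEquivRel-tests : isEquivRel R ≡ reflexivity ∧ (symmetry ∧ transitivity)
    isEquivRel-tests = proj₂ (proj₂ equivalenceTests)

    symTest-sound : ∀ i j → symTest i j ≡ true → R i j ≡ true → R j i ≡ true
    symTest-sound i j test Rij with R i j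
    ... | true = test

    symTest-complete : ∀ i j → (R i j ≡ true → R j i ≡ true) → symTest i j ≡ true
    symTest-complete i j sym-ij with R i j
    ... | true  = sym-ij refl
    ... | false = refl

    transTest-sound : ∀ i j k → transTest i j k ≡ true → R i j ≡ true → R j k ≡ true → R i k ≡ true
    transTest-sound i j k test Rij Rjk with R i j | R j k
    ... | true | true = test

    transTest-complete : ∀ i j k → (R i j ≡ true → R j k ≡ true → R i k ≡ true) → transTest i j k ≡ true
    transTest-complete i j k trans-ijk with R i j | R j k
    ... | true  | true  = trans-ijk refl refl
    ... | true  | false = refl
    ... | false | _     = refl

  isEquivRel-sound : isEquivRel R ≡ true → IsEquivalenceᵇ R
  isEquivRel-sound eqv = record
    { reflexive  = allFin-true⁻ (∧-conicalˡ reflexivity _ tests)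
    ; symmetric  = λ i j → symTest-sound i j (allFin-true⁻ (allFin-true⁻ (∧-conicalˡ symmetry _ sym∧trans) i) j)
    ; transitive = λ i j k →
        transTest-sound i j k (allFin-true⁻ (allFin-true⁻ (allFin-true⁻ (∧-conicalʳ symmetry _ sym∧trans) i) j) k)
    }
    where
    tests : reflexivity ∧ (symmetry ∧ transitivity) ≡ true
    tests = trans (sym isEquivRel-tests) eqv
    sym∧trans : symmetry ∧ transitivity ≡ true
    sym∧trans = ∧-conicalʳ reflexivity _ tests

  isEquivRel-complete : IsEquivalenceᵇ R → isEquivRel R ≡ true
  isEquivRel-complete eqv = trans isEquivRel-tests
    (∧-true (allFin-true⁺ reflexive)
      (∧-true (allFin-true⁺ λ i → allFin-true⁺ λ j → symTest-complete i j (symmetric i j))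
              (allFin-true⁺ λ i → allFin-true⁺ λ j → allFin-true⁺ λ k → transTest-complete i j k (transitive i j k))))
    where open IsEquivalenceᵇ eqv

record IsColouring {n} (G : Graph n) (R : BoolRel n) : Set where
  field
    equivalence : IsEquivalenceᵇ R
    independent   : ∀ i j → R i j ≡ true → adj G i j ≡ false
  open IsEquivalenceᵇ equivalence public

module _ {n : ℕ} {G : Graph n} {R : BoolRel n} where

  isColoringPartition-sound : isColoringPartition G R ≡ true → IsColouring G R
  isColoringPartition-sound col = record
    { equivalence = isEquivRel-sound (∧-conicalˡ (isEquivRel R) _ col)
    ; independent   = λ i j → not-∧-true⁻ (allFin-true⁻ (allFin-true⁻ (∧-conicalʳ (isEquivRel R) _ col) i) j)
    }

  isColoringPartition-complete : IsColouring G R → isColoringPartition G R ≡ true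
  isColoringPartition-complete col = ∧-true (isEquivRel-complete equivalence)
    (allFin-true⁺ λ i → allFin-true⁺ λ j → not-∧-true⁺ (independent i j))
    where open IsColouring col

IsColouring-resp-≐ : ∀ {n} {G : Graph n} {R S : BoolRel n} → R ≐ S → IsColouring G R → IsColouring G S
IsColouring-resp-≐ {R = R} {S} R≐S col = record
  { equivalence = record
    { reflexive  = λ i → R⇒S i i (reflexive i)
    ; symmetric  = λ i j Sij → R⇒S j i (symmetric i j (S⇒R i j Sij))
    ; transitive = λ i j k Sij Sjk → R⇒S i k (transitive i j k (S⇒R i j Sij) (S⇒R j k Sjk))
    }
  ; independent = λ i j Sij → independent i j (S⇒R i j Sij)
  }
  where
  open IsColouring col
  S⇒R : ∀ i j → S i j ≡ true → R i j ≡ true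
  S⇒R i j = trans (R≐S i j)
  R⇒S : ∀ i j → R i j ≡ true → S i j ≡ true
  R⇒S i j = trans (sym (R≐S i j))

isColoringPartition-cong : ∀ {n} (G : Graph n) → Extensional (𝟙 ∘ isColoringPartition G)
isColoringPartition-cong G {R} {S} R≐S = cong 𝟙 (true-⇔⇒≡
  (isColoringPartition-complete {G = G} {R = S} ∘ IsColouring-resp-≐ R≐S ∘ isColoringPartition-sound)
  (isColoringPartition-complete {G = G} {R = R} ∘ IsColouring-resp-≐ (λ i j → sym (R≐S i j)) ∘ isColoringPartition-sound))

<ᵇ-true⁻ : ∀ m n → (m <ᵇ n) ≡ true → m < n
<ᵇ-true⁻ m n m<ᵇn = ℕ.<ᵇ⇒< m n (subst T (sym m<ᵇn) tt)

<ᵇ-true⁺ : ∀ {m n} → m < n → (m <ᵇ n) ≡ true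
<ᵇ-true⁺ {m} {n} m<n with m <ᵇ n | ℕ.<⇒<ᵇ m<n
... | true | _ = refl

<ᵇ-false⁻ : ∀ m n → (m <ᵇ n) ≡ false → n ≤ m
<ᵇ-false⁻ m n m≮ᵇn = ℕ.≮⇒≥ (λ m<n → subst T m≮ᵇn (ℕ.<⇒<ᵇ m<n))

<ᵇ-false⁺ : ∀ {m n} → n ≤ m → (m <ᵇ n) ≡ false
<ᵇ-false⁺ {m} {n} n≤m with m <ᵇ n in m<ᵇn
... | true  = ⊥-elim (ℕ.≤⇒≯ n≤m (<ᵇ-true⁻ m n m<ᵇn))
... | false = refl

punchIn-<ᵇ : ∀ {m} (v : Fin (suc m)) i j → (toℕ (punchIn v j) <ᵇ toℕ (punchIn v i)) ≡ (toℕ j <ᵇ toℕ i)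
punchIn-<ᵇ zero    i       j       = refl
punchIn-<ᵇ (suc v) zero    zero    = refl
punchIn-<ᵇ (suc v) (suc i) zero    = refl
punchIn-<ᵇ (suc v) zero    (suc j) = <ᵇ-false⁺ {toℕ (punchIn (suc v) (suc j))} z≤n
punchIn-<ᵇ (suc v) (suc i) (suc j) = punchIn-<ᵇ v i j

isRepresentative : ∀ {n} → BoolRel n → Fin n → Bool
isRepresentative {n} R i = all (λ j → not (R j i ∧ (toℕ j <ᵇ toℕ i))) (allFin n)

numBlocks-∑ : ∀ {n} (R : BoolRel n) → numBlocks R ≡ ∑[ i < n ] 𝟙 (isRepresentative R i)
numBlocks-∑ {n} R = trans (length-filterᵇ _ (allFin n)) (∑ₗ-allFin n _)

numBlocks-cong : ∀ {n} → Extensional (numBlocks {n})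
numBlocks-cong {R = R} {S} R≐S = trans (numBlocks-∑ R) (trans (sum-cong-≗ (λ i → cong 𝟙 (all-cong (allFin _)
  (λ j → cong (λ b → not (b ∧ (toℕ j <ᵇ toℕ i))) (R≐S j i))))) (sym (numBlocks-∑ S)))

module _ {n : ℕ} {R : BoolRel n} where

  isRepresentative-sound : ∀ {i} → isRepresentative R i ≡ true → ∀ j → R j i ≡ true → toℕ i ≤ toℕ j
  isRepresentative-sound rep j Rji = <ᵇ-false⁻ _ _ (not-∧-true⁻ (allFin-true⁻ rep j) Rji)

  isRepresentative-complete : ∀ {i} → (∀ j → R j i ≡ true → toℕ i ≤ toℕ j) → isRepresentative R i ≡ true
  isRepresentative-complete least = allFin-true⁺ λ j → not-∧-true⁺ (<ᵇ-false⁺ ∘ least j)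

  representative-unique : (∀ i j → R i j ≡ true → R j i ≡ true) →
    ∀ {i u} → isRepresentative R i ≡ true → isRepresentative R u ≡ true → R u i ≡ true → i ≡ u
  representative-unique symmetric {i} {u} rep-i rep-u Rui = toℕ-injective (ℕ.≤-antisym
    (isRepresentative-sound rep-i u Rui) (isRepresentative-sound rep-u i (symmetric u i Rui)))

least-witness : ∀ {n} (β : Fin n → Bool) c → β c ≡ true →
  ∃ λ μ → β μ ≡ true × (∀ j → β j ≡ true → toℕ μ ≤ toℕ j)
least-witness β zero βc = zero , βc , λ _ _ → z≤n
least-witness β (suc c) βc with β zero in β0
... | true  = zero , β0 , λ _ _ → z≤n
... | false with least-witness (β ∘ suc) c βc
...   | μ , βμ , least = suc μ , βμ , least′
  where
  least′ : ∀ j → β j ≡ true → toℕ (suc μ) ≤ toℕ j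
  least′ zero    βj = ⊥-elim (true≢false (trans (sym βj) β0))
  least′ (suc j) βj = s≤s (least j βj)

module _ {n : ℕ} {R : BoolRel n} (eqv : IsEquivalenceᵇ R) where
  open IsEquivalenceᵇ eqv

  representative-count : ∀ c → ∑[ u < n ] (𝟙 (isRepresentative R u) * 𝟙 (R c u)) ≡ 1
  representative-count c with least-witness (R c) c (reflexive c)
  ... | μ , Rcμ , least = begin
    ∑[ u < n ] (𝟙 (isRepresentative R u) * 𝟙 (R c u)) ≡⟨ ∑-single _ μ others ⟩
    𝟙 (isRepresentative R μ) * 𝟙 (R c μ)              ≡⟨ cong₂ (λ a b → 𝟙 a * 𝟙 b) rep-μ Rcμ ⟩
    1                                                  ∎
    where
    rep-μ : isRepresentative R μ ≡ true
    rep-μ = isRepresentative-complete {R = R} λ j Rjμ → least j (transitive c μ j Rcμ (symmetric j μ Rjμ))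
    others : ∀ u → u ≢ μ → 𝟙 (isRepresentative R u) * 𝟙 (R c u) ≡ 0
    others u u≢μ = 𝟙-*-exclusive λ rep-u Rcu →
      u≢μ (representative-unique symmetric rep-u rep-μ (transitive μ c u (symmetric c μ Rcμ) Rcu))

representative-zero : ∀ {n} (R : BoolRel (suc n)) → isRepresentative R zero ≡ true
representative-zero R = isRepresentative-complete {R = R} λ _ _ → z≤n

numBlocks-positive : ∀ {n} (R : BoolRel (suc n)) → 1 ≤ numBlocks R
numBlocks-positive {n} R = subst (1 ≤_) (sym (numBlocks-∑ R))
  (subst (λ b → 1 ≤ 𝟙 b + ∑[ i < n ] 𝟙 (isRepresentative R (suc i))) (sym (representative-zero R)) (s≤s z≤n))

numBlocks-≤ : ∀ {n} (R : BoolRel n) → numBlocks R ≤ n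
numBlocks-≤ R = subst (_≤ _) (sym (numBlocks-∑ R)) (∑-𝟙≤ (isRepresentative R))

weighted-∑-S : ∀ {n} (G : Graph (suc n)) (c : ℕ → ℕ) →
  ∑ₗ (upTo (suc n)) (λ k → c (suc k) * S G (suc k))
    ≡ ∑[ R ∈ allRels (suc n) ] (𝟙 (isColoringPartition G R) * c (numBlocks R))
weighted-∑-S {n} G c = begin
  ∑ₗ (upTo (suc n)) (λ k → c (suc k) * S G (suc k))
    ≡⟨ ∑ₗ-applyUpTo id (suc n) _ ⟩
  ∑[ i < suc n ] (w i * S G (suc (toℕ i)))
    ≡⟨ sum-cong-≗ {suc n} (λ i → trans (cong (w i *_) (length-filterᵇ _ rels)) (sym (*-distribˡ-∑ₗ rels (w i) (has i)))) ⟩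
  ∑[ i < suc n ] ∑[ R ∈ rels ] (w i * has i R)
    ≡⟨ ∑-∑ₗ-comm {n = suc n} rels (λ i R → w i * has i R) ⟩
  ∑[ R ∈ rels ] ∑[ i < suc n ] (w i * has i R)
    ≡⟨ ∑ₗ-cong rels (λ R → trans (*-distribˡ-sum {suc n} (𝟙 (col R)) (λ i → 𝟙 (numBlocks R ≡ᵇ suc (toℕ i)) * w i))
                                  (sum-cong-≗ {suc n} (λ i → sym (rearrange R i)))) ⟨
  ∑[ R ∈ rels ] (𝟙 (col R) * ∑[ i < suc n ] (𝟙 (numBlocks R ≡ᵇ suc (toℕ i)) * w i))
    ≡⟨ ∑ₗ-cong rels (λ R → cong (𝟙 (col R) *_) (∑-select (suc n) (numBlocks R) c (numBlocks-positive R) (numBlocks-≤ R))) ⟩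
  ∑[ R ∈ rels ] (𝟙 (col R) * c (numBlocks R)) ∎
  where
  rels : List (BoolRel (suc n))
  rels = allRels (suc n)
  col : BoolRel (suc n) → Bool
  col = isColoringPartition G
  w : Fin (suc n) → ℕ
  w i = c (suc (toℕ i))
  has : Fin (suc n) → BoolRel (suc n) → ℕ
  has i R = 𝟙 (col R ∧ (numBlocks R ≡ᵇ suc (toℕ i)))
  rearrange : ∀ R i → w i * has i R ≡ 𝟙 (col R) * (𝟙 (numBlocks R ≡ᵇ suc (toℕ i)) * w i)
  rearrange R i = trans (cong (w i *_) (𝟙-∧ (col R) _))
    (solve 3 (λ x y z → x :* (y :* z) := y :* (z :* x)) refl (w i) (𝟙 (col R)) (𝟙 (numBlocks R ≡ᵇ suc (toℕ i))))

𝓑-∑ : ∀ {n} (G : Graph (suc n)) → 𝓑 G ≡ ∑[ R ∈ allRels (suc n) ] 𝟙 (isColoringPartition G R)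
𝓑-∑ {n} G = begin
  𝓑 G                                                        ≡⟨ ∑ₗ-cong (upTo (suc n)) (λ k → ℕ.*-identityˡ (S G (suc k))) ⟨
  ∑ₗ (upTo (suc n)) (λ k → 1 * S G (suc k))                  ≡⟨ weighted-∑-S G (λ _ → 1) ⟩
  ∑[ R ∈ allRels (suc n) ] (𝟙 (isColoringPartition G R) * 1) ≡⟨ ∑ₗ-cong (allRels (suc n)) (λ R → ℕ.*-identityʳ _) ⟩
  ∑[ R ∈ allRels (suc n) ] 𝟙 (isColoringPartition G R)       ∎

𝓣-∑ : ∀ {n} (G : Graph (suc n)) → 𝓣 G ≡ ∑[ R ∈ allRels (suc n) ] (𝟙 (isColoringPartition G R) * numBlocks R)
𝓣-∑ G = weighted-∑-S G id

discrete : ∀ {n} → BoolRel n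
discrete i j = does (i ≟ j)

discrete-true⁻ : ∀ {n} {i j : Fin n} → discrete i j ≡ true → i ≡ j
discrete-true⁻ {i = i} {j} i≈j with i ≟ j
... | yes i≡j = i≡j

discrete-isColouring : ∀ {n} (G : Graph n) → IsColouring G discrete
discrete-isColouring G = record
  { equivalence = record
    { reflexive  = λ i → dec-true (i ≟ i) refl
    ; symmetric  = λ i j i≈j → dec-true (j ≟ i) (sym (discrete-true⁻ i≈j))
    ; transitive = λ i j k i≈j j≈k → dec-true (i ≟ k) (trans (discrete-true⁻ i≈j) (discrete-true⁻ j≈k))
    }
  ; independent = λ i j i≈j → subst (λ j → adj G i j ≡ false) (discrete-true⁻ i≈j) (irrefl G i)
  }

𝓑-positive : ∀ {n} (G : Graph (suc n)) → 1 ≤ 𝓑 G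
𝓑-positive {n} G = subst (1 ≤_) (sym (𝓑-∑ G))
  (ℕ.≤-trans (ℕ.≤-reflexive discrete-selected) (∑ₗ-mono (allRels (suc n)) (λ R → 𝟙-*-≤ (R ≈ᵇ discrete) _)))
  where
  col : BoolRel (suc n) → Bool
  col = isColoringPartition G
  discrete-selected : 1 ≡ ∑[ R ∈ allRels (suc n) ] (𝟙 (R ≈ᵇ discrete) * 𝟙 (col R))
  discrete-selected = begin
    1                                                        ≡⟨ cong 𝟙 (isColoringPartition-complete (discrete-isColouring G)) ⟨
    𝟙 (col discrete)                                         ≡⟨ allRels-select (suc n) (𝟙 ∘ col) (isColoringPartition-cong G) discrete ⟨
    ∑[ R ∈ allRels (suc n) ] (𝟙 (R ≈ᵇ discrete) * 𝟙 (col R)) ∎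

-- Deleting a vertex

punchOutᴹ : ∀ {m} (v x : Fin (suc m)) → Maybe (Fin m)
punchOutᴹ zero    zero    = nothing
punchOutᴹ zero    (suc x) = just x
punchOutᴹ {suc m} (suc v) zero    = just zero
punchOutᴹ {suc m} (suc v) (suc x) = Maybe.map suc (punchOutᴹ v x)

punchOutᴹ-self : ∀ {m} (v : Fin (suc m)) → punchOutᴹ v v ≡ nothing
punchOutᴹ-self zero = refl
punchOutᴹ-self {suc m} (suc v) rewrite punchOutᴹ-self v = refl

punchOutᴹ-punchIn : ∀ {m} (v : Fin (suc m)) i → punchOutᴹ v (punchIn v i) ≡ just i
punchOutᴹ-punchIn zero    i = refl
punchOutᴹ-punchIn {suc m} (suc v) zero    = refl
punchOutᴹ-punchIn {suc m} (suc v) (suc i) rewrite punchOutᴹ-punchIn v i = refl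

module Deletion {m : ℕ} (G : Graph (suc m)) (v : Fin (suc m)) where

  H : Graph m
  H = G ─ v

  p : Fin m → Fin (suc m)
  p = punchIn v

  neighbour : Fin m → Bool
  neighbour j = adj G v (p j)

  restrict : BoolRel (suc m) → BoolRel m
  restrict R i j = R (p i) (p j)

  -- v is added to the block {j | r j ≡ true}; r is constantly false when v forms its own block.
  extend : BoolRel m → (Fin m → Bool) → BoolRel (suc m)
  extend R′ r x y = on (punchOutᴹ v x) (punchOutᴹ v y)
    where
    on : Maybe (Fin m) → Maybe (Fin m) → Bool
    on nothing  nothing  = true
    on nothing  (just j) = r j
    on (just i) nothing  = r i
    on (just i) (just j) = R′ i j

  module _ (R′ : BoolRel m) (r : Fin m → Bool) where

    extend-vv : extend R′ r v v ≡ true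
    extend-vv rewrite punchOutᴹ-self v = refl

    extend-vp : ∀ j → extend R′ r v (p j) ≡ r j
    extend-vp j rewrite punchOutᴹ-self v | punchOutᴹ-punchIn v j = refl

    extend-pv : ∀ i → extend R′ r (p i) v ≡ r i
    extend-pv i rewrite punchOutᴹ-self v | punchOutᴹ-punchIn v i = refl

    extend-pp : ∀ i j → extend R′ r (p i) (p j) ≡ R′ i j
    extend-pp i j rewrite punchOutᴹ-punchIn v i | punchOutᴹ-punchIn v j = refl

  record IsAdmissibleRow (R′ : BoolRel m) (r : Fin m → Bool) : Set where
    field
      closed       : ∀ j k → r j ≡ true → R′ j k ≡ true → r k ≡ true
      connected    : ∀ j k → r j ≡ true → r k ≡ true → R′ j k ≡ true
      non-adjacent : ∀ j → r j ≡ true → neighbour j ≡ false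

  extend-isColouring : ∀ {R′ r} → IsColouring H R′ → IsAdmissibleRow R′ r → IsColouring G (extend R′ r)
  extend-isColouring {R′} {r} col adm = record
    { equivalence = record { reflexive = reflexive′ ; symmetric = symmetric′ ; transitive = transitive′ }
    ; independent = independent′
    }
    where
    open IsColouring col
    open IsAdmissibleRow adm
    E : BoolRel (suc m)
    E = extend R′ r
    vp : ∀ j → E v (p j) ≡ r j
    vp = extend-vp R′ r
    pv : ∀ i → E (p i) v ≡ r i
    pv = extend-pv R′ r
    pp : ∀ i j → E (p i) (p j) ≡ R′ i j
    pp = extend-pp R′ r
    from : ∀ {a b} → a ≡ b → a ≡ true → b ≡ true
    from a≡b = trans (sym a≡b)

    reflexive′ : ∀ x → E x x ≡ true
    reflexive′ x with punchIn-view v x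
    ... | at-v      = extend-vv R′ r
    ... | punched i = trans (pp i i) (reflexive i)

    symmetric′ : ∀ x y → E x y ≡ true → E y x ≡ true
    symmetric′ x y Exy with punchIn-view v x | punchIn-view v y
    ... | at-v      | at-v      = Exy
    ... | at-v      | punched j = trans (pv j) (from (vp j) Exy)
    ... | punched i | at-v      = trans (vp i) (from (pv i) Exy)
    ... | punched i | punched j = trans (pp j i) (symmetric i j (from (pp i j) Exy))

    transitive′ : ∀ x y z → E x y ≡ true → E y z ≡ true → E x z ≡ true
    transitive′ x y z Exy Eyz with punchIn-view v x | punchIn-view v y | punchIn-view v z
    ... | at-v      | at-v      | _         = Eyz
    ... | _         | at-v      | at-v      = Exy
    ... | at-v      | punched j | at-v      = extend-vv R′ r
    ... | at-v      | punched j | punched k = trans (vp k) (closed j k (from (vp j) Exy) (from (pp j k) Eyz))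
    ... | punched i | at-v      | punched k = trans (pp i k) (connected i k (from (pv i) Exy) (from (vp k) Eyz))
    ... | punched i | punched j | at-v      = trans (pv i) (closed j i (from (pv j) Eyz) (symmetric i j (from (pp i j) Exy)))
    ... | punched i | punched j | punched k = trans (pp i k) (transitive i j k (from (pp i j) Exy) (from (pp j k) Eyz))

    independent′ : ∀ x y → E x y ≡ true → adj G x y ≡ false
    independent′ x y Exy with punchIn-view v x | punchIn-view v y
    ... | at-v      | at-v      = irrefl G v
    ... | at-v      | punched j = non-adjacent j (from (vp j) Exy)
    ... | punched i | at-v      = trans (Graph.sym G (p i) v) (non-adjacent i (from (pv i) Exy))
    ... | punched i | punched j = independent i j (from (pp i j) Exy)

  restrict-isColouring : ∀ {R} → IsColouring G R → IsColouring H (restrict R)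
  restrict-isColouring col = record
    { equivalence = record
      { reflexive  = λ i → reflexive (p i)
      ; symmetric  = λ i j → symmetric (p i) (p j)
      ; transitive = λ i j k → transitive (p i) (p j) (p k)
      }
    ; independent = λ i j → independent (p i) (p j)
    }
    where open IsColouring col

  alone : BoolRel m → BoolRel (suc m)
  alone R′ = extend R′ (λ _ → false)

  join : BoolRel m → Fin m → BoolRel (suc m)
  join R′ u = extend R′ (R′ u)

  avoidsNeighbours : BoolRel m → Fin m → Bool
  avoidsNeighbours R′ u = all (λ j → not (R′ u j ∧ neighbour j)) (allFin m)

  joinable : BoolRel m → Fin m → Bool
  joinable R′ u = isRepresentative R′ u ∧ avoidsNeighbours R′ u

  alone-admissible : ∀ R′ → IsAdmissibleRow R′ (λ _ → false)
  alone-admissible R′ = record { closed = λ _ _ () ; connected = λ _ _ () ; non-adjacent = λ _ () }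

  join-admissible : ∀ {R′ u} → IsEquivalenceᵇ R′ → avoidsNeighbours R′ u ≡ true → IsAdmissibleRow R′ (R′ u)
  join-admissible {R′} {u} eqv avoids = record
    { closed       = transitive u
    ; connected    = λ j k Ruj Ruk → transitive j u k (symmetric u j Ruj) Ruk
    ; non-adjacent = λ j → not-∧-true⁻ (allFin-true⁻ avoids j)
    }
    where open IsEquivalenceᵇ eqv

  module _ {R : BoolRel (suc m)} (R′ : BoolRel m) (r : Fin m → Bool) (R≈E : R ≈ᵇ extend R′ r ≡ true) where

    ≈ᵇ-extend-row : ∀ j → R v (p j) ≡ r j
    ≈ᵇ-extend-row j = trans (≈ᵇ-sound {R = R} {S = extend R′ r} R≈E v (p j)) (extend-vp R′ r j)

    ≈ᵇ-extend-restrict : restrict R ≐ R′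
    ≈ᵇ-extend-restrict i j = trans (≈ᵇ-sound {R = R} {S = extend R′ r} R≈E (p i) (p j)) (extend-pp R′ r i j)

  ≈ᵇ-extend : ∀ {R R′ r} → IsEquivalenceᵇ R → restrict R ≐ R′ → (∀ j → R v (p j) ≡ r j) → R ≈ᵇ extend R′ r ≡ true
  ≈ᵇ-extend {R} {R′} {r} eqv R|≐R′ row = ≈ᵇ-complete {R = R} {S = extend R′ r} entry
    where
    open IsEquivalenceᵇ eqv
    entry : ∀ x y → R x y ≡ extend R′ r x y
    entry x y with punchIn-view v x | punchIn-view v y
    ... | at-v      | at-v      = trans (reflexive v) (sym (extend-vv R′ r))
    ... | at-v      | punched j = trans (row j) (sym (extend-vp R′ r j))
    ... | punched i | at-v      = trans (true-⇔⇒≡ (symmetric (p i) v) (symmetric v (p i))) (trans (row i) (sym (extend-pv R′ r i)))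
    ... | punched i | punched j = trans (R|≐R′ i j) (sym (extend-pp R′ r i j))

  fibre : BoolRel (suc m) → BoolRel m → ℕ
  fibre R R′ = 𝟙 (R ≈ᵇ alone R′) + ∑[ u < m ] (𝟙 (joinable R′ u) * 𝟙 (R ≈ᵇ join R′ u))

  module _ {R : BoolRel (suc m)} {R′ : BoolRel m} (col : IsColouring G R) (R|≐R′ : restrict R ≐ R′) where
    open IsColouring col
    private
      col′ : IsColouring H R′
      col′ = IsColouring-resp-≐ R|≐R′ (restrict-isColouring col)
      module R′ = IsColouring col′

    fibre-empty-row : (∀ j → R v (p j) ≡ false) → fibre R R′ ≡ 1
    fibre-empty-row empty = cong₂ _+_ alone-matches (∑-zero _ (λ u → 𝟙-*-exclusive {joinable R′ u} λ _ → join-differs u))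
      where
      alone-matches : 𝟙 (R ≈ᵇ alone R′) ≡ 1
      alone-matches = cong 𝟙 (≈ᵇ-extend equivalence R|≐R′ empty)
      join-differs : ∀ u → R ≈ᵇ join R′ u ≡ true → ⊥
      join-differs u R≈J = true≢false (trans (sym (R′.reflexive u)) (trans (sym (≈ᵇ-extend-row {R = R} R′ (R′ u) R≈J u)) (empty u)))

    fibre-nonempty-row : ∀ j₀ → R v (p j₀) ≡ true → fibre R R′ ≡ 1
    fibre-nonempty-row j₀ Rvj₀ = cong₂ _+_ alone-differs (trans (sum-cong-≗ join-matches) (representative-count R′.equivalence j₀))
      where
      row : ∀ j → R v (p j) ≡ R′ j₀ j
      row j = true-⇔⇒≡
        (λ Rvj → trans (sym (R|≐R′ j₀ j)) (transitive (p j₀) v (p j) (symmetric v (p j₀) Rvj₀) Rvj))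
        (λ R′j₀j → transitive v (p j₀) (p j) Rvj₀ (trans (R|≐R′ j₀ j) R′j₀j))
      alone-differs : 𝟙 (R ≈ᵇ alone R′) ≡ 0
      alone-differs with R ≈ᵇ alone R′ in R≈A
      ... | false = refl
      ... | true  = ⊥-elim (true≢false (trans (sym Rvj₀) (≈ᵇ-extend-row {R = R} R′ (λ _ → false) R≈A j₀)))
      join-iff : ∀ u → R ≈ᵇ join R′ u ≡ R′ j₀ u
      join-iff u = true-⇔⇒≡
        (λ R≈J → R′.symmetric u j₀ (trans (sym (≈ᵇ-extend-row {R = R} R′ (R′ u) R≈J j₀)) Rvj₀))
        (λ R′j₀u → ≈ᵇ-extend equivalence R|≐R′ λ j →
           trans (row j) (true-⇔⇒≡ (R′.transitive u j₀ j (R′.symmetric j₀ u R′j₀u)) (R′.transitive j₀ u j R′j₀u)))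
      avoids : ∀ u → R′ j₀ u ≡ true → avoidsNeighbours R′ u ≡ true
      avoids u R′j₀u = allFin-true⁺ λ j → not-∧-true⁺ λ R′uj →
        independent v (p j) (trans (row j) (R′.transitive j₀ u j R′j₀u R′uj))
      join-matches : ∀ u → 𝟙 (joinable R′ u) * 𝟙 (R ≈ᵇ join R′ u) ≡ 𝟙 (isRepresentative R′ u) * 𝟙 (R′ j₀ u)
      join-matches u = trans (cong (λ b → 𝟙 (joinable R′ u) * 𝟙 b) (join-iff u)) (𝟙-∧-absorb (isRepresentative R′ u) (avoids u))

    fibre-one : fibre R R′ ≡ 1
    fibre-one with all (λ j → not (R v (p j))) (allFin m) in row-test
    ... | true  = fibre-empty-row (λ j → not-true⁻ (allFin-true⁻ row-test j))
    ... | false with allFin-false⁻ row-test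
    ...   | j₀ , Rvj₀ = fibre-nonempty-row j₀ (not-false⁻ Rvj₀)

  restrict-indicator : ∀ {R} → IsColouring G R → ∀ R′ →
    𝟙 (R′ ≈ᵇ restrict R) ≡ 𝟙 (isColoringPartition H R′) * fibre R R′
  restrict-indicator {R} col R′ with R′ ≈ᵇ restrict R in R′≈R|
  ... | true  = sym (cong₂ (λ c f → 𝟙 c * f) (isColoringPartition-complete col′) (fibre-one col R|≐R′))
    where
    R|≐R′ : restrict R ≐ R′
    R|≐R′ i j = sym (≈ᵇ-sound {R = R′} {S = restrict R} R′≈R| i j)
    col′ : IsColouring H R′
    col′ = IsColouring-resp-≐ R|≐R′ (restrict-isColouring col)
  ... | false = sym (trans (cong (𝟙 (isColoringPartition H R′) *_) no-extension) (ℕ.*-zeroʳ (𝟙 (isColoringPartition H R′))))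
    where
    differs : ∀ r → 𝟙 (R ≈ᵇ extend R′ r) ≡ 0
    differs r with R ≈ᵇ extend R′ r in R≈E
    ... | false = refl
    ... | true  = ⊥-elim (true≢false (trans (sym (≈ᵇ-complete {R = R′} {S = restrict R} λ i j →
                    sym (≈ᵇ-extend-restrict {R = R} R′ r R≈E i j))) R′≈R|))
    no-extension : fibre R R′ ≡ 0
    no-extension = cong₂ _+_ (differs _)
      (∑-zero _ (λ u → trans (cong (𝟙 (joinable R′ u) *_) (differs (R′ u))) (ℕ.*-zeroʳ (𝟙 (joinable R′ u)))))

  fibre-∑ : ∀ (F : BoolRel (suc m) → ℕ) → Extensional F → ∀ R′ →
    ∑[ R ∈ allRels (suc m) ] (fibre R R′ * F R) ≡ F (alone R′) + ∑[ u < m ] (𝟙 (joinable R′ u) * F (join R′ u))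
  fibre-∑ F F-ext R′ = begin
    ∑[ R ∈ rels ] (fibre R R′ * F R)
      ≡⟨ ∑ₗ-cong rels (λ R → ℕ.*-distribʳ-+ (F R) (𝟙 (R ≈ᵇ alone R′)) _) ⟩
    ∑[ R ∈ rels ] (𝟙 (R ≈ᵇ alone R′) * F R + (∑[ u < m ] (𝟙 (joinable R′ u) * 𝟙 (R ≈ᵇ join R′ u))) * F R)
      ≡⟨ ∑ₗ-distrib-+ rels _ _ ⟩
    ∑[ R ∈ rels ] (𝟙 (R ≈ᵇ alone R′) * F R) + ∑[ R ∈ rels ] ((∑[ u < m ] (𝟙 (joinable R′ u) * 𝟙 (R ≈ᵇ join R′ u))) * F R)
      ≡⟨ cong₂ _+_ (allRels-select (suc m) F F-ext (alone R′))
                   (∑ₗ-cong rels λ R → sym (*-distribʳ-∑ (F R) (λ u → 𝟙 (joinable R′ u) * 𝟙 (R ≈ᵇ join R′ u)))) ⟩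
    F (alone R′) + ∑[ R ∈ rels ] ∑[ u < m ] (𝟙 (joinable R′ u) * 𝟙 (R ≈ᵇ join R′ u) * F R)
      ≡⟨ cong (F (alone R′) +_) (∑-∑ₗ-comm rels (λ u R → 𝟙 (joinable R′ u) * 𝟙 (R ≈ᵇ join R′ u) * F R)) ⟨
    F (alone R′) + ∑[ u < m ] ∑[ R ∈ rels ] (𝟙 (joinable R′ u) * 𝟙 (R ≈ᵇ join R′ u) * F R)
      ≡⟨ cong (F (alone R′) +_) (sum-cong-≗ {m} λ u → select u) ⟩
    F (alone R′) + ∑[ u < m ] (𝟙 (joinable R′ u) * F (join R′ u))
      ∎
    where
    rels : List (BoolRel (suc m))
    rels = allRels (suc m)
    select : ∀ u → ∑[ R ∈ rels ] (𝟙 (joinable R′ u) * 𝟙 (R ≈ᵇ join R′ u) * F R) ≡ 𝟙 (joinable R′ u) * F (join R′ u)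
    select u = begin
      ∑[ R ∈ rels ] (𝟙 (joinable R′ u) * 𝟙 (R ≈ᵇ join R′ u) * F R)   ≡⟨ ∑ₗ-cong rels (λ R → ℕ.*-assoc (𝟙 (joinable R′ u)) _ _) ⟩
      ∑[ R ∈ rels ] (𝟙 (joinable R′ u) * (𝟙 (R ≈ᵇ join R′ u) * F R)) ≡⟨ *-distribˡ-∑ₗ rels (𝟙 (joinable R′ u)) _ ⟩
      𝟙 (joinable R′ u) * ∑[ R ∈ rels ] (𝟙 (R ≈ᵇ join R′ u) * F R)   ≡⟨ cong (𝟙 (joinable R′ u) *_) (allRels-select (suc m) F F-ext (join R′ u)) ⟩
      𝟙 (joinable R′ u) * F (join R′ u)                               ∎

  ∑-colourings-by-restriction : ∀ (w : BoolRel (suc m) → ℕ) → Extensional w →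
    ∑[ R ∈ allRels (suc m) ] (𝟙 (isColoringPartition G R) * w R) ≡
    ∑[ R′ ∈ allRels m ] (𝟙 (isColoringPartition H R′) * (w (alone R′) + ∑[ u < m ] (𝟙 (joinable R′ u) * w (join R′ u))))
  ∑-colourings-by-restriction w w-ext = begin
    ∑[ R ∈ relsG ] F R
      ≡⟨ ∑ₗ-cong relsG (λ R → trans (cong (_* F R) (allRels-unique m (restrict R))) (ℕ.*-identityˡ (F R))) ⟨
    ∑[ R ∈ relsG ] (∑[ R′ ∈ relsH ] 𝟙 (R′ ≈ᵇ restrict R) * F R)
      ≡⟨ ∑ₗ-cong relsG (λ R → *-distribʳ-∑ₗ relsH (F R) (λ R′ → 𝟙 (R′ ≈ᵇ restrict R))) ⟨
    ∑[ R ∈ relsG ] ∑[ R′ ∈ relsH ] (𝟙 (R′ ≈ᵇ restrict R) * F R)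
      ≡⟨ ∑ₗ-comm relsG relsH (λ R R′ → 𝟙 (R′ ≈ᵇ restrict R) * F R) ⟩
    ∑[ R′ ∈ relsH ] ∑[ R ∈ relsG ] (𝟙 (R′ ≈ᵇ restrict R) * F R)
      ≡⟨ ∑ₗ-cong relsH (λ R′ → ∑ₗ-cong relsG (λ R → by-fibre R R′)) ⟩
    ∑[ R′ ∈ relsH ] ∑[ R ∈ relsG ] (𝟙 (colH R′) * (fibre R R′ * F R))
      ≡⟨ ∑ₗ-cong relsH (λ R′ → *-distribˡ-∑ₗ relsG (𝟙 (colH R′)) (λ R → fibre R R′ * F R)) ⟩
    ∑[ R′ ∈ relsH ] (𝟙 (colH R′) * ∑[ R ∈ relsG ] (fibre R R′ * F R))
      ≡⟨ ∑ₗ-cong relsH (λ R′ → cong (𝟙 (colH R′) *_) (fibre-∑ F F-ext R′)) ⟩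
    ∑[ R′ ∈ relsH ] (𝟙 (colH R′) * (F (alone R′) + ∑[ u < m ] (𝟙 (joinable R′ u) * F (join R′ u))))
      ≡⟨ ∑ₗ-cong relsH (λ R′ → 𝟙-*-cong (colH R′) (extensions-colour R′)) ⟩
    ∑[ R′ ∈ relsH ] (𝟙 (colH R′) * (w (alone R′) + ∑[ u < m ] (𝟙 (joinable R′ u) * w (join R′ u))))
      ∎
    where
    relsG : List (BoolRel (suc m))
    relsG = allRels (suc m)
    relsH : List (BoolRel m)
    relsH = allRels m
    colG : BoolRel (suc m) → Bool
    colG = isColoringPartition G
    colH : BoolRel m → Bool
    colH = isColoringPartition H
    F : BoolRel (suc m) → ℕ
    F R = 𝟙 (colG R) * w R
    F-ext : Extensional F
    F-ext R≐S = cong₂ _*_ (isColoringPartition-cong G R≐S) (w-ext R≐S)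
    by-fibre : ∀ R R′ → 𝟙 (R′ ≈ᵇ restrict R) * F R ≡ 𝟙 (colH R′) * (fibre R R′ * F R)
    by-fibre R R′ with colG R in colG-R
    ... | false = trans (ℕ.*-zeroʳ (𝟙 (R′ ≈ᵇ restrict R)))
                        (sym (trans (cong (𝟙 (colH R′) *_) (ℕ.*-zeroʳ (fibre R R′))) (ℕ.*-zeroʳ (𝟙 (colH R′)))))
    ... | true  = trans (cong (_* (1 * w R)) (restrict-indicator {R} (isColoringPartition-sound colG-R) R′))
                        (ℕ.*-assoc (𝟙 (colH R′)) (fibre R R′) (1 * w R))
    extensions-colour : ∀ R′ → colH R′ ≡ true →
      F (alone R′) + ∑[ u < m ] (𝟙 (joinable R′ u) * F (join R′ u)) ≡ w (alone R′) + ∑[ u < m ] (𝟙 (joinable R′ u) * w (join R′ u))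
    extensions-colour R′ colH-R′ = cong₂ _+_ (coloured (alone-admissible R′))
      (sum-cong-≗ {m} λ u → 𝟙-*-cong (joinable R′ u) λ joinable-u →
        coloured (join-admissible (IsColouring.equivalence col′) (∧-conicalʳ (isRepresentative R′ u) _ joinable-u)))
      where
      col′ : IsColouring H R′
      col′ = isColoringPartition-sound colH-R′
      coloured : ∀ {r} → IsAdmissibleRow R′ r → F (extend R′ r) ≡ w (extend R′ r)
      coloured {r} adm = trans (cong (λ c → 𝟙 c * w (extend R′ r)) (isColoringPartition-complete (extend-isColouring col′ adm)))
                               (ℕ.*-identityˡ (w (extend R′ r)))

  module _ (R′ : BoolRel m) (r : Fin m → Bool) where

    representative-extend-p : ∀ i →
      isRepresentative (extend R′ r) (p i) ≡ not (r i ∧ (toℕ v <ᵇ toℕ (p i))) ∧ isRepresentative R′ i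
    representative-extend-p i = trans (allFin-punchIn v _) (cong₂ (λ a b → not (a ∧ (toℕ v <ᵇ toℕ (p i))) ∧ b)
      (extend-vp R′ r i)
      (all-cong (allFin m) λ j → cong₂ (λ a b → not (a ∧ b)) (extend-pp R′ r j i) (punchIn-<ᵇ v i j)))

    representative-extend-v :
      isRepresentative (extend R′ r) v ≡ all (λ j → not (r j ∧ (toℕ (p j) <ᵇ toℕ v))) (allFin m)
    representative-extend-v = begin
      isRepresentative (extend R′ r) v
        ≡⟨ allFin-punchIn v _ ⟩
      not (extend R′ r v v ∧ (toℕ v <ᵇ toℕ v)) ∧ others
        ≡⟨ cong₂ (λ a b → not (a ∧ b) ∧ others) (extend-vv R′ r) (<ᵇ-false⁺ {toℕ v} ℕ.≤-refl) ⟩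
      others
        ≡⟨ all-cong (allFin m) (λ j → cong (λ a → not (a ∧ (toℕ (p j) <ᵇ toℕ v))) (extend-pv R′ r j)) ⟩
      all (λ j → not (r j ∧ (toℕ (p j) <ᵇ toℕ v))) (allFin m) ∎
      where
      others : Bool
      others = all (λ j → not (extend R′ r (p j) v ∧ (toℕ (p j) <ᵇ toℕ v))) (allFin m)

    numBlocks-extend : numBlocks (extend R′ r) ≡
      𝟙 (isRepresentative (extend R′ r) v) + ∑[ i < m ] 𝟙 (not (r i ∧ (toℕ v <ᵇ toℕ (p i))) ∧ isRepresentative R′ i)
    numBlocks-extend = begin
      numBlocks (extend R′ r)                                    ≡⟨ numBlocks-∑ (extend R′ r) ⟩
      ∑[ x < suc m ] 𝟙 (isRepresentative (extend R′ r) x)        ≡⟨ sum-remove {i = v} (λ x → 𝟙 (isRepresentative (extend R′ r) x)) ⟩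
      𝟙 (isRepresentative (extend R′ r) v) + ∑[ i < m ] 𝟙 (isRepresentative (extend R′ r) (p i))
        ≡⟨ cong (𝟙 (isRepresentative (extend R′ r) v) +_) (sum-cong-≗ {m} (cong 𝟙 ∘ representative-extend-p)) ⟩
      𝟙 (isRepresentative (extend R′ r) v) + ∑[ i < m ] 𝟙 (not (r i ∧ (toℕ v <ᵇ toℕ (p i))) ∧ isRepresentative R′ i) ∎

  numBlocks-alone : ∀ R′ → numBlocks (alone R′) ≡ suc (numBlocks R′)
  numBlocks-alone R′ = trans (numBlocks-extend R′ (λ _ → false))
    (cong₂ _+_ (cong 𝟙 (trans (representative-extend-v R′ (λ _ → false))
                              (allFin-true⁺ {p = λ j → not (false ∧ (toℕ (p j) <ᵇ toℕ v))} λ _ → refl)))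
               (sym (numBlocks-∑ R′)))

  numBlocks-join : ∀ {R′ u} → IsEquivalenceᵇ R′ → isRepresentative R′ u ≡ true → numBlocks (join R′ u) ≡ numBlocks R′
  numBlocks-join {R′} {u} eqv rep-u = begin
    numBlocks (join R′ u)
      ≡⟨ numBlocks-extend R′ (R′ u) ⟩
    𝟙 (isRepresentative (join R′ u) v) + ∑[ i < m ] 𝟙 (not (c i) ∧ isRepresentative R′ i)
      ≡⟨ cong (_+ ∑[ i < m ] 𝟙 (not (c i) ∧ isRepresentative R′ i)) (trans v-representative (sym u-counted)) ⟩
    ∑[ i < m ] 𝟙 (c i ∧ isRepresentative R′ i) + ∑[ i < m ] 𝟙 (not (c i) ∧ isRepresentative R′ i)
      ≡⟨ ∑-distrib-+ (λ i → 𝟙 (c i ∧ isRepresentative R′ i)) (λ i → 𝟙 (not (c i) ∧ isRepresentative R′ i)) ⟨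
    ∑[ i < m ] (𝟙 (c i ∧ isRepresentative R′ i) + 𝟙 (not (c i) ∧ isRepresentative R′ i))
      ≡⟨ sum-cong-≗ {m} (λ i → 𝟙-split (c i) (isRepresentative R′ i)) ⟩
    ∑[ i < m ] 𝟙 (isRepresentative R′ i)
      ≡⟨ numBlocks-∑ R′ ⟨
    numBlocks R′ ∎
    where
    open IsEquivalenceᵇ eqv
    -- the representatives of R′ that lose their status once v joins the block of u
    c : Fin m → Bool
    c i = R′ u i ∧ (toℕ v <ᵇ toℕ (p i))
    u-counted : ∑[ i < m ] 𝟙 (c i ∧ isRepresentative R′ i) ≡ 𝟙 (toℕ v <ᵇ toℕ (p u))
    u-counted = begin
      ∑[ i < m ] 𝟙 (c i ∧ isRepresentative R′ i)                  ≡⟨ ∑-single _ u others ⟩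
      𝟙 ((R′ u u ∧ (toℕ v <ᵇ toℕ (p u))) ∧ isRepresentative R′ u) ≡⟨ cong₂ (λ a b → 𝟙 ((a ∧ _) ∧ b)) (reflexive u) rep-u ⟩
      𝟙 ((toℕ v <ᵇ toℕ (p u)) ∧ true)                              ≡⟨ cong 𝟙 (∧-identityʳ _) ⟩
      𝟙 (toℕ v <ᵇ toℕ (p u))                                       ∎
      where
      others : ∀ i → i ≢ u → 𝟙 (c i ∧ isRepresentative R′ i) ≡ 0
      others i i≢u = trans (𝟙-∧ (c i) _) (𝟙-*-exclusive λ ci rep-i →
        i≢u (representative-unique symmetric rep-i rep-u (∧-conicalˡ (R′ u i) _ ci)))
    v-representative : 𝟙 (isRepresentative (join R′ u) v) ≡ 𝟙 (toℕ v <ᵇ toℕ (p u))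
    v-representative = cong 𝟙 (trans (representative-extend-v R′ (R′ u)) (true-⇔⇒≡ precedes first))
      where
      pu≢v : toℕ (p u) ≢ toℕ v
      pu≢v pu≡v = punchInᵢ≢i v u (toℕ-injective pu≡v)
      precedes : all (λ j → not (R′ u j ∧ (toℕ (p j) <ᵇ toℕ v))) (allFin m) ≡ true → (toℕ v <ᵇ toℕ (p u)) ≡ true
      precedes none-before with toℕ v <ᵇ toℕ (p u) in v<pu
      ... | true  = refl
      ... | false = ⊥-elim (true≢false (trans (sym (<ᵇ-true⁺ pu<v))
                      (not-∧-true⁻ (allFin-true⁻ none-before u) (reflexive u))))
        where
        pu<v : toℕ (p u) < toℕ v
        pu<v = ℕ.≤∧≢⇒< (<ᵇ-false⁻ (toℕ v) (toℕ (p u)) v<pu) pu≢v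
      first : (toℕ v <ᵇ toℕ (p u)) ≡ true → all (λ j → not (R′ u j ∧ (toℕ (p j) <ᵇ toℕ v))) (allFin m) ≡ true
      first v<pu = allFin-true⁺ λ j → not-∧-true⁺ λ R′uj → <ᵇ-false⁺ {toℕ (p j)} (ℕ.<⇒≤ (ℕ.<-≤-trans
        (<ᵇ-true⁻ (toℕ v) (toℕ (p u)) v<pu)
        (<ᵇ-false⁻ (toℕ (p j)) (toℕ (p u))
          (trans (punchIn-<ᵇ v u j) (<ᵇ-false⁺ (isRepresentative-sound {R = R′} rep-u j (symmetric u j R′uj)))))))

  degree : ℕ
  degree = ∑[ j < m ] 𝟙 (neighbour j)

  module _ (simplicial : Simplicial G v) {R′ : BoolRel m} (col : IsColouring H R′) where
    open IsColouring col

    -- Two neighbours of a simplicial vertex are adjacent, so no block holds more than one.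
    neighbours-in-block : ∀ u → ∑[ j < m ] (𝟙 (neighbour j) * 𝟙 (R′ j u)) ≡ 𝟙 (not (avoidsNeighbours R′ u))
    neighbours-in-block u with avoidsNeighbours R′ u in avoids
    ... | true  = ∑-zero _ λ j → 𝟙-*-exclusive λ nbr-j R′ju →
                    true≢false (trans (sym nbr-j) (not-∧-true⁻ (allFin-true⁻ avoids j) (symmetric j u R′ju)))
    ... | false with allFin-false⁻ avoids
    ...   | j₀ , meets = trans (∑-single _ j₀ others) (cong₂ (λ a b → 𝟙 a * 𝟙 b) nbr-j₀ (symmetric u j₀ R′uj₀))
      where
      R′uj₀ : R′ u j₀ ≡ true
      R′uj₀ = ∧-conicalˡ (R′ u j₀) _ (not-false⁻ meets)
      nbr-j₀ : neighbour j₀ ≡ true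
      nbr-j₀ = ∧-conicalʳ (R′ u j₀) _ (not-false⁻ meets)
      others : ∀ j → j ≢ j₀ → 𝟙 (neighbour j) * 𝟙 (R′ j u) ≡ 0
      others j j≢j₀ = 𝟙-*-exclusive λ nbr-j R′ju → true≢false (trans
        (sym (simplicial (p j) (p j₀) nbr-j nbr-j₀ (j≢j₀ ∘ punchIn-injective v j j₀)))
        (independent j j₀ (transitive j u j₀ R′ju R′uj₀)))

    joinable-count : ∑[ u < m ] 𝟙 (joinable R′ u) + degree ≡ numBlocks R′
    joinable-count = begin
      ∑[ u < m ] 𝟙 (joinable R′ u) + degree
        ≡⟨ cong (∑[ u < m ] 𝟙 (joinable R′ u) +_) blocked ⟨
      ∑[ u < m ] 𝟙 (joinable R′ u) + ∑[ u < m ] (𝟙 (not (avoidsNeighbours R′ u)) * 𝟙 (isRepresentative R′ u))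
        ≡⟨ ∑-distrib-+ (λ u → 𝟙 (joinable R′ u)) (λ u → 𝟙 (not (avoidsNeighbours R′ u)) * 𝟙 (isRepresentative R′ u)) ⟨
      ∑[ u < m ] (𝟙 (joinable R′ u) + 𝟙 (not (avoidsNeighbours R′ u)) * 𝟙 (isRepresentative R′ u))
        ≡⟨ sum-cong-≗ {m} split ⟩
      ∑[ u < m ] 𝟙 (isRepresentative R′ u)
        ≡⟨ numBlocks-∑ R′ ⟨
      numBlocks R′ ∎
      where
      split : ∀ u → 𝟙 (joinable R′ u) + 𝟙 (not (avoidsNeighbours R′ u)) * 𝟙 (isRepresentative R′ u) ≡ 𝟙 (isRepresentative R′ u)
      split u = trans (cong₂ _+_ (cong 𝟙 (∧-comm (isRepresentative R′ u) _)) (sym (𝟙-∧ (not (avoidsNeighbours R′ u)) _)))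
                      (𝟙-split (avoidsNeighbours R′ u) (isRepresentative R′ u))
      blocked : ∑[ u < m ] (𝟙 (not (avoidsNeighbours R′ u)) * 𝟙 (isRepresentative R′ u)) ≡ degree
      blocked = begin
        ∑[ u < m ] (𝟙 (not (avoidsNeighbours R′ u)) * 𝟙 (isRepresentative R′ u))
          ≡⟨ sum-cong-≗ {m} (λ u → cong (_* 𝟙 (isRepresentative R′ u)) (neighbours-in-block u)) ⟨
        ∑[ u < m ] (∑[ j < m ] (𝟙 (neighbour j) * 𝟙 (R′ j u)) * 𝟙 (isRepresentative R′ u))
          ≡⟨ sum-cong-≗ {m} (λ u → sym (*-distribʳ-∑ (𝟙 (isRepresentative R′ u)) (λ j → 𝟙 (neighbour j) * 𝟙 (R′ j u)))) ⟩
        ∑[ u < m ] ∑[ j < m ] (𝟙 (neighbour j) * 𝟙 (R′ j u) * 𝟙 (isRepresentative R′ u))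
          ≡⟨ ∑-comm (λ u j → 𝟙 (neighbour j) * 𝟙 (R′ j u) * 𝟙 (isRepresentative R′ u)) ⟩
        ∑[ j < m ] ∑[ u < m ] (𝟙 (neighbour j) * 𝟙 (R′ j u) * 𝟙 (isRepresentative R′ u))
          ≡⟨ sum-cong-≗ {m} (λ j → trans (sum-cong-≗ {m} (λ u → reassoc (𝟙 (neighbour j)) (𝟙 (R′ j u)) (𝟙 (isRepresentative R′ u))))
                                          (sym (*-distribˡ-sum (𝟙 (neighbour j)) (λ u → 𝟙 (isRepresentative R′ u) * 𝟙 (R′ j u))))) ⟩
        ∑[ j < m ] (𝟙 (neighbour j) * ∑[ u < m ] (𝟙 (isRepresentative R′ u) * 𝟙 (R′ j u)))
          ≡⟨ sum-cong-≗ {m} (λ j → trans (cong (𝟙 (neighbour j) *_) (representative-count equivalence j)) (ℕ.*-identityʳ _)) ⟩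
        degree ∎
        where
        reassoc : ∀ a b c → a * b * c ≡ a * (c * b)
        reassoc = solve 3 (λ a b c → a :* b :* c := a :* (c :* b)) refl

-- A simplicial vertex

blockMoment₂ : ∀ {n} → Graph n → ℕ
blockMoment₂ {n} G = ∑[ R ∈ allRels n ] (𝟙 (isColoringPartition G R) * (numBlocks R * numBlocks R))

𝓣²≤𝓑*blockMoment₂ : ∀ {n} (G : Graph (suc n)) → 𝓣 G * 𝓣 G ≤ 𝓑 G * blockMoment₂ G
𝓣²≤𝓑*blockMoment₂ G rewrite 𝓣-∑ G | 𝓑-∑ G = cauchy-schwarz (𝟙 ∘ isColoringPartition G) numBlocks (allRels _)

module _ {n : ℕ} (G : Graph (suc (suc n))) (v : Fin (suc (suc n))) (simplicial : Simplicial G v) where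
  open Deletion G v

  private
    relsG : List (BoolRel (suc (suc n)))
    relsG = allRels (suc (suc n))
    colG : BoolRel (suc (suc n)) → Bool
    colG = isColoringPartition G
    relsH : List (BoolRel (suc n))
    relsH = allRels (suc n)
    colH : BoolRel (suc n) → Bool
    colH = isColoringPartition H
    joinables : BoolRel (suc n) → ℕ
    joinables R′ = ∑[ u < suc n ] 𝟙 (joinable R′ u)

    joinables+degree : ∀ R′ → colH R′ ≡ true → joinables R′ + degree ≡ numBlocks R′
    joinables+degree R′ col = joinable-count simplicial (isColoringPartition-sound {G = H} {R = R′} col)

  𝓑-simplicial : 𝓑 G + degree * 𝓑 H ≡ 𝓑 H + 𝓣 H
  𝓑-simplicial = begin
    𝓑 G + degree * 𝓑 H
      ≡⟨ cong₂ (λ b b′ → b + degree * b′) (trans (𝓑-∑ G) (∑ₗ-cong relsG λ R → sym (ℕ.*-identityʳ (𝟙 (colG R))))) (𝓑-∑ H) ⟩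
    ∑[ R ∈ relsG ] (𝟙 (colG R) * 1) + degree * ∑[ R′ ∈ relsH ] 𝟙 (colH R′)
      ≡⟨ cong (_+ degree * ∑[ R′ ∈ relsH ] 𝟙 (colH R′)) (∑-colourings-by-restriction (λ _ → 1) (λ _ → refl)) ⟩
    ∑[ R′ ∈ relsH ] (𝟙 (colH R′) * B′ R′) + degree * ∑[ R′ ∈ relsH ] 𝟙 (colH R′)
      ≡⟨ ∑ₗ-combine relsH (λ R′ → 𝟙 (colH R′) * B′ R′) (𝟙 ∘ colH) degree ⟩
    ∑[ R′ ∈ relsH ] (𝟙 (colH R′) * B′ R′ + degree * 𝟙 (colH R′))
      ≡⟨ ∑ₗ-cong relsH termwise ⟩
    ∑[ R′ ∈ relsH ] (𝟙 (colH R′) + 𝟙 (colH R′) * numBlocks R′)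
      ≡⟨ ∑ₗ-distrib-+ relsH _ _ ⟩
    ∑[ R′ ∈ relsH ] 𝟙 (colH R′) + ∑[ R′ ∈ relsH ] (𝟙 (colH R′) * numBlocks R′)
      ≡⟨ cong₂ _+_ (𝓑-∑ H) (𝓣-∑ H) ⟨
    𝓑 H + 𝓣 H ∎
    where
    B′ : BoolRel (suc n) → ℕ
    B′ R′ = 1 + ∑[ u < suc n ] (𝟙 (joinable R′ u) * 1)
    termwise : ∀ R′ → 𝟙 (colH R′) * B′ R′ + degree * 𝟙 (colH R′) ≡ 𝟙 (colH R′) + 𝟙 (colH R′) * numBlocks R′
    termwise R′ with colH R′ in col
    ... | false = ℕ.*-zeroʳ degree
    ... | true  = begin
      1 * (1 + ∑[ u < suc n ] (𝟙 (joinable R′ u) * 1)) + degree * 1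
        ≡⟨ cong (λ j → 1 * (1 + j) + degree * 1) (sum-cong-≗ {suc n} λ u → ℕ.*-identityʳ (𝟙 (joinable R′ u))) ⟩
      1 * (1 + joinables R′) + degree * 1
        ≡⟨ solve 2 (λ j d → con 1 :* (con 1 :+ j) :+ d :* con 1 := con 1 :+ con 1 :* (j :+ d)) refl (joinables R′) degree ⟩
      1 + 1 * (joinables R′ + degree)
        ≡⟨ cong (λ k → 1 + 1 * k) (joinables+degree R′ col) ⟩
      1 + 1 * numBlocks R′ ∎

  𝓣-simplicial : 𝓣 G + degree * 𝓣 H ≡ 𝓑 H + 𝓣 H + blockMoment₂ H
  𝓣-simplicial = begin
    𝓣 G + degree * 𝓣 H
      ≡⟨ cong₂ (λ t t′ → t + degree * t′) (trans (𝓣-∑ G) (∑-colourings-by-restriction numBlocks numBlocks-cong)) (𝓣-∑ H) ⟩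
    ∑[ R′ ∈ relsH ] (𝟙 (colH R′) * T′ R′) + degree * ∑[ R′ ∈ relsH ] (𝟙 (colH R′) * numBlocks R′)
      ≡⟨ ∑ₗ-combine relsH (λ R′ → 𝟙 (colH R′) * T′ R′) (λ R′ → 𝟙 (colH R′) * numBlocks R′) degree ⟩
    ∑[ R′ ∈ relsH ] (𝟙 (colH R′) * T′ R′ + degree * (𝟙 (colH R′) * numBlocks R′))
      ≡⟨ ∑ₗ-cong relsH termwise ⟩
    ∑[ R′ ∈ relsH ] (𝟙 (colH R′) + 𝟙 (colH R′) * numBlocks R′ + 𝟙 (colH R′) * (numBlocks R′ * numBlocks R′))
      ≡⟨ ∑ₗ-distrib-+ relsH _ _ ⟩
    ∑[ R′ ∈ relsH ] (𝟙 (colH R′) + 𝟙 (colH R′) * numBlocks R′) + blockMoment₂ H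
      ≡⟨ cong (_+ blockMoment₂ H) (trans (∑ₗ-distrib-+ relsH _ _) (sym (cong₂ _+_ (𝓑-∑ H) (𝓣-∑ H)))) ⟩
    𝓑 H + 𝓣 H + blockMoment₂ H ∎
    where
    T′ : BoolRel (suc n) → ℕ
    T′ R′ = numBlocks (alone R′) + ∑[ u < suc n ] (𝟙 (joinable R′ u) * numBlocks (join R′ u))
    termwise : ∀ R′ → 𝟙 (colH R′) * T′ R′ + degree * (𝟙 (colH R′) * numBlocks R′)
                     ≡ 𝟙 (colH R′) + 𝟙 (colH R′) * numBlocks R′ + 𝟙 (colH R′) * (numBlocks R′ * numBlocks R′)
    termwise R′ with colH R′ in col
    ... | false = ℕ.*-zeroʳ degree
    ... | true  = begin
      1 * T′ R′ + degree * (1 * ν)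
        ≡⟨ cong (λ t → 1 * t + degree * (1 * ν)) (cong₂ _+_ (numBlocks-alone R′) joins) ⟩
      1 * (1 + ν + joinables R′ * ν) + degree * (1 * ν)
        ≡⟨ solve 3 (λ ν j d → con 1 :* (con 1 :+ ν :+ j :* ν) :+ d :* (con 1 :* ν)
                           := con 1 :+ con 1 :* ν :+ con 1 :* ((j :+ d) :* ν)) refl ν (joinables R′) degree ⟩
      1 + 1 * ν + 1 * ((joinables R′ + degree) * ν)
        ≡⟨ cong (λ k → 1 + 1 * ν + 1 * (k * ν)) (joinables+degree R′ col) ⟩
      1 + 1 * ν + 1 * (ν * ν) ∎
      where
      ν : ℕ
      ν = numBlocks R′
      eqv : IsEquivalenceᵇ R′
      eqv = IsColouring.equivalence (isColoringPartition-sound {G = H} {R = R′} col)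
      joins : ∑[ u < suc n ] (𝟙 (joinable R′ u) * numBlocks (join R′ u)) ≡ joinables R′ * ν
      joins = trans (sum-cong-≗ {suc n} λ u → 𝟙-*-cong (joinable R′ u) (numBlocks-join eqv ∘ ∧-conicalˡ _ _))
                    (*-distribʳ-∑ ν (λ u → 𝟙 (joinable R′ u)))

corollary6 : (n : ℕ) (G : Graph (suc (suc n))) (v : Fin (suc (suc n))) →
    Simplicial G v → 𝓐 (G ─ v) ℚ.< 𝓐 G
corollary6 n G v simplicial = ratio-< (𝓑-positive H) (𝓑-positive G)
  (ratio-grows (𝓑 H) (𝓣 H) (blockMoment₂ H) degree (𝓑 G) (𝓣 G)
    (𝓑-simplicial G v simplicial) (𝓣-simplicial G v simplicial) (𝓣²≤𝓑*blockMoment₂ H) (𝓑-positive H))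
  where open Deletion G v
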